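{- Let $a=a_1a_2\cdots a_n$ be a signed permutation on $[n]$. Let $\tilde s=(0,a_1,a_2,\ldots,a_n,-a_n,-a_{n-1},\ldots,-a_1)$ and $p=(0,-1,-2,\ldots,-n,n,n-1,\ldots,1)$, both cycles on $[n]^{\pm}=\{ -n,\ldots,0,\ldots,n\}$. Let $b=b_0b_1\cdots b_{2n+1}$ be the sequence obtained from $a$ by replacing each $a_i$ by the two entries $(-a_i)\,a_i$, prepending $0$ and appending $-(n+1)$, and define fixed-point-free involutions on $[n]^{\pm}\cup\{ -n-1\}$: $$\theta_1=(b_0,b_1)(b_2,b_3)\cdots(b_{2n},b_{2n+1}),\qquad \theta_2=(0,-1)(1,-2)\cdots(n,-n-1).$$ Then $C(p\tilde s)=C(\theta_1\theta_2)-1$.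
   Context: A signed permutation on $[n]$ is a sequence $a_1\cdots a_n$ with $a_i\in\{\pm1,\ldots,\pm n\}$ such that $|a_1|,\ldots,|a_n|$ is a permutation of $[n]$. Permutations are composed right to left and $C(\sigma)$ is the number of cycles of $\sigma$. ($\theta_1,\theta_2$ encode the black and grey edges of the Bafna–Pevzner breakpoint graph of $a$.) -}

module Defs where

open import Data.Bool using (Bool; true; false; if_then_else_)
open import Data.Nat as ℕ using (ℕ; zero; suc; _∸_)
open import Data.Integer as ℤ using (ℤ; +_; -_; _≟_; _≤ᵇ_; ∣_∣)
open import Data.List using (List; []; _∷_; _++_; map; reverse; length; upTo; filter; concatMap)
open import Data.Product using (_×_; _,_)
open import Data.Vec using (Vec; toList)
open import Data.Fin using (Fin)
open import Function.Definitions using (Injective)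
open import Relation.Binary.PropositionalEquality using (_≡_)
open import Relation.Nullary.Decidable using (⌊_⌋)
open import Data.Bool using (T)

IsSignedPerm : (n : ℕ) → Vec ℤ n → Set
IsSignedPerm n a =
  ((i : Fin n) → (1 ℕ.≤ ∣ Data.Vec.lookup a i ∣) × (∣ Data.Vec.lookup a i ∣ ℕ.≤ n))
  × Injective _≡_ _≡_ (λ i → ∣ Data.Vec.lookup a i ∣)

-- Permutations are represented as functions ℤ → ℤ; composition is
-- right to left: (σ ∘ τ) x = σ (τ x).

private
  cycleGo : ℤ → List ℤ → ℤ → ℤ
  cycleGo c₀ []            x = x
  cycleGo c₀ (c ∷ [])      x = if ⌊ x ≟ c ⌋ then c₀ else x
  cycleGo c₀ (c ∷ d ∷ cs)  x = if ⌊ x ≟ c ⌋ then d else cycleGo c₀ (d ∷ cs) x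

cyclePerm : List ℤ → ℤ → ℤ
cyclePerm []       x = x
cyclePerm (c ∷ cs) x = cycleGo c (c ∷ cs) x

transpositions : List (ℤ × ℤ) → ℤ → ℤ
transpositions []             z = z
transpositions ((x , y) ∷ ps) z =
  if ⌊ z ≟ x ⌋ then y else if ⌊ z ≟ y ⌋ then x else transpositions ps z

pairUp : List ℤ → List (ℤ × ℤ)
pairUp (x ∷ y ∷ rest) = (x , y) ∷ pairUp rest
pairUp _              = []

-- Number of cycles C(σ) of a permutation σ of a finite set D (given as a
-- list of its distinct elements): each cycle is counted once, through its
-- least element, i.e. the x ∈ D with x ≤ σᵏ(x) for all k < |D|.

iter : (ℤ → ℤ) → ℕ → ℤ → ℤ
iter σ zero    x = x
iter σ (suc k) x = σ (iter σ k x)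

allB : (ℕ → Bool) → List ℕ → Bool
allB f []       = true
allB f (k ∷ ks) = if f k then allB f ks else false

isCycleMin : (ℤ → ℤ) → ℕ → ℤ → Bool
isCycleMin σ m x = allB (λ k → x ≤ᵇ iter σ k x) (upTo m)

numCycles : List ℤ → (ℤ → ℤ) → ℕ
numCycles D σ = length (filter (λ x → Data.Bool.Properties.T? (isCycleMin σ (length D) x)) D)
  where import Data.Bool.Properties

oneToN : ℕ → List ℤ
oneToN n = map (λ i → + suc i) (upTo n)

signedSet : ℕ → List ℤ
signedSet n = map -_ (oneToN n) ++ (+ 0) ∷ oneToN n

signedSetExt : ℕ → List ℤ
signedSetExt n = (- (+ suc n)) ∷ signedSet n

sTilde : {n : ℕ} → Vec ℤ n → ℤ → ℤ
sTilde a = cyclePerm ((+ 0) ∷ toList a ++ reverse (map -_ (toList a)))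

pCycle : ℕ → ℤ → ℤ
pCycle n = cyclePerm ((+ 0) ∷ map -_ (oneToN n) ++ reverse (oneToN n))

bSeq : {n : ℕ} → Vec ℤ n → List ℤ
bSeq {n} a = (+ 0) ∷ concatMap (λ x → - x ∷ x ∷ []) (toList a) ++ (- (+ suc n)) ∷ []

theta1 : {n : ℕ} → Vec ℤ n → ℤ → ℤ
theta1 a = transpositions (pairUp (bSeq a))

theta2 : ℕ → ℤ → ℤ
theta2 n = transpositions (map (λ i → (+ i , - (+ suc i))) (upTo (suc n)))

-- Away from aₙ one has s̃ = -θ₁, while θ₂ x = -1-x and
-- p y = y-1 (except p(-n) = n); so τ = θ₁θ₂ is inverse to σ = p s̃ except that it sends σ aₙ to -n-1,
-- -n-1 to σ⁻¹ n, and n to aₙ. The map J x = p(-x) satisfies σJσ = J and swaps aₙ with σ aₙ, so it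
-- reverses the σ-cycle of aₙ, which therefore has odd length 2m+1 with n in the middle. Rerouting
-- through -n-1 splits this cycle into two τ-cycles, one of them containing -n-1, and all other cycles
-- are common to σ and τ. When aₙ = n, instead, -n-1 is a fixed point of τ and τ = σ⁻¹ elsewhere.

module Submission where

open import Data.Bool using (Bool; true; false; if_then_else_; T; _∧_; not)
import Data.Bool.Properties as 𝔹P
open import Data.Empty using (⊥; ⊥-elim)
open import Data.Fin using (Fin; zero; suc; toℕ; fromℕ<; punchOut)
import Data.Fin.Properties as FinP
open import Data.Integer as ℤ using (ℤ; +_; -_; -[1+_]; _≟_; ∣_∣; -<+; -<-)
import Data.Integer.Properties as ℤP
open import Data.List using (List; []; _∷_; _++_; [_]; map; reverse; length; upTo; applyUpTo; filter; lookup; concatMap)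
import Data.List.Extrema ℤP.≤-totalOrder as ℤExtrema
import Data.List.Properties as ListP
open import Data.List.Membership.DecPropositional ℤ._≟_ using (_∈?_)
open import Data.List.Membership.Propositional using (_∈_; _∉_)
open import Data.List.Membership.Propositional.Properties
  using (∈-map⁺; ∈-map⁻; ∈-upTo⁺; ∈-upTo⁻; ∈-++⁺ˡ; ∈-++⁺ʳ; ∈-++⁻)
open import Data.List.Relation.Unary.All as All using ([]; _∷_)
open import Data.List.Relation.Unary.AllPairs using ([]; _∷_)
open import Data.List.Relation.Unary.Any using (here; there; index)
open import Data.List.Relation.Unary.Any.Properties using (lookup-index; reverse⁻)
open import Data.List.Relation.Unary.Unique.Propositional using (Unique)
import Data.List.Relation.Unary.Unique.Propositional.Properties as UniqueP
open import Data.Nat as ℕ using (ℕ; zero; suc; _+_; _*_; _∸_; _%_; _/_; z≤n; s≤s)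
import Data.Nat.DivMod as ℕD
import Data.Nat.Properties as ℕP
open import Data.Product using (∃-syntax; _×_; _,_; proj₁; proj₂)
open import Data.Sum using (_⊎_; inj₁; inj₂; [_,_]′)
open import Data.Unit using (tt)
open import Data.Vec as Vec using (Vec; []; _∷_)
open import Data.Vec.Membership.Propositional.Properties using (∈-toList⁺; ∈-toList⁻; ∈-lookup)
import Data.Vec.Relation.Unary.Any as VecAny
import Data.Vec.Relation.Unary.Any.Properties as VecAnyP
open import Function using (_∘_; flip; Equivalence)
open import Function.Definitions using (Injective)
open import Relation.Binary.Definitions using (tri<; tri≈; tri>)
open import Relation.Binary.PropositionalEquality hiding ([_]; J)
open import Relation.Nullary using (¬_; Dec; yes; no; does)
open import Relation.Unary using (Decidable)
open import Defs

-- Iterates, periods and cycle minima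

Closed : (ℤ → ℤ) → List ℤ → Set
Closed σ L = ∀ {x} → x ∈ L → σ x ∈ L

InjectiveOn : (ℤ → ℤ) → List ℤ → Set
InjectiveOn σ L = ∀ {x y} → x ∈ L → y ∈ L → σ x ≡ σ y → x ≡ y

iter-comm : ∀ σ k x → iter σ k (σ x) ≡ σ (iter σ k x)
iter-comm σ zero    x = refl
iter-comm σ (suc k) x = cong σ (iter-comm σ k x)

iter-+ : ∀ σ j k x → iter σ (j + k) x ≡ iter σ j (iter σ k x)
iter-+ σ zero    k x = refl
iter-+ σ (suc j) k x = cong σ (iter-+ σ j k x)

iter-closed : ∀ {σ L} → Closed σ L → ∀ k {x} → x ∈ L → iter σ k x ∈ L
iter-closed cl zero    x∈ = x∈
iter-closed cl (suc k) x∈ = cl (iter-closed cl k x∈)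

iter-injectiveOn : ∀ {σ L} → Closed σ L → InjectiveOn σ L → ∀ k → InjectiveOn (iter σ k) L
iter-injectiveOn cl inj zero    x∈ y∈ e = e
iter-injectiveOn cl inj (suc k) x∈ y∈ e =
  iter-injectiveOn cl inj k x∈ y∈ (inj (iter-closed cl k x∈) (iter-closed cl k y∈) e)

iter-*-period : ∀ σ ℓ x → iter σ ℓ x ≡ x → ∀ t → iter σ (t * ℓ) x ≡ x
iter-*-period σ ℓ x e zero    = refl
iter-*-period σ ℓ x e (suc t) =
  trans (iter-+ σ ℓ (t * ℓ) x) (trans (cong (iter σ ℓ) (iter-*-period σ ℓ x e t)) e)

iter-%-period : ∀ σ P x → iter σ (suc P) x ≡ x → ∀ k → iter σ k x ≡ iter σ (k % suc P) x
iter-%-period σ P x e k = begin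
    iter σ k x
  ≡⟨ cong (λ t → iter σ t x) (ℕD.m≡m%n+[m/n]*n k (suc P)) ⟩
    iter σ (k % suc P + (k / suc P) * suc P) x
  ≡⟨ iter-+ σ (k % suc P) _ x ⟩
    iter σ (k % suc P) (iter σ ((k / suc P) * suc P) x)
  ≡⟨ cong (iter σ (k % suc P)) (iter-*-period σ (suc P) x e (k / suc P)) ⟩
    iter σ (k % suc P) x ∎
  where open ≡-Reasoning

iter-∸-period : ∀ σ P x → iter σ P x ≡ x → ∀ {j} → j ℕ.≤ P → ∀ r →
  iter σ (r + (P ∸ j)) (iter σ j x) ≡ iter σ r x
iter-∸-period σ P x e {j} j≤P r = begin
    iter σ (r + (P ∸ j)) (iter σ j x)
  ≡⟨ sym (iter-+ σ (r + (P ∸ j)) j x) ⟩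
    iter σ (r + (P ∸ j) + j) x
  ≡⟨ cong (λ t → iter σ t x) (trans (ℕP.+-assoc r (P ∸ j) j) (cong (r ℕ.+_) (ℕP.m∸n+n≡m j≤P))) ⟩
    iter σ (r + P) x
  ≡⟨ iter-+ σ r P x ⟩
    iter σ r (iter σ P x)
  ≡⟨ cong (iter σ r) e ⟩
    iter σ r x ∎
  where open ≡-Reasoning

PeriodAtMost : (ℤ → ℤ) → ℕ → ℤ → Set
PeriodAtMost σ m x = ∃[ ℓ ] (1 ℕ.≤ ℓ × ℓ ℕ.≤ m × iter σ ℓ x ≡ x)

Periodic : (ℤ → ℤ) → ℤ → Set
Periodic σ x = ∃[ ℓ ] (1 ℕ.≤ ℓ × iter σ ℓ x ≡ x)

periodAtMost⇒periodic : ∀ {σ m x} → PeriodAtMost σ m x → Periodic σ x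
periodAtMost⇒periodic (ℓ , ℓ≥1 , _ , e) = ℓ , ℓ≥1 , e

-- Pigeonhole on the positions in L of x, σ x, …, σ^|L| x.
iter-collision : ∀ {σ L} → Closed σ L → ∀ {x} → x ∈ L →
  ∃[ i ] ∃[ j ] (i ℕ.< j × j ℕ.≤ length L × iter σ i x ≡ iter σ j x)
iter-collision {σ} {L} cl {x} x∈
  with i , j , i<j , same-position ←
         FinP.pigeonhole (ℕP.n<1+n (length L)) (λ k → index (iter-closed cl (toℕ k) x∈)) =
  toℕ i , toℕ j , i<j , ℕP.≤-pred (FinP.toℕ<n j) ,
  trans (lookup-index (iter-closed cl (toℕ i) x∈))
        (trans (cong (lookup L) same-position) (sym (lookup-index (iter-closed cl (toℕ j) x∈))))

periodAtMost-length : ∀ {σ L} → Closed σ L → InjectiveOn σ L → ∀ {x} → x ∈ L →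
  PeriodAtMost σ (length L) x
periodAtMost-length {σ} cl inj {x} x∈ with i , j , i<j , j≤|L| , σⁱx≡σʲx ← iter-collision cl x∈ =
  j ∸ i , ℕP.m<n⇒0<n∸m i<j , ℕP.≤-trans (ℕP.m∸n≤m j i) j≤|L| ,
  iter-injectiveOn cl inj i (iter-closed cl (j ∸ i) x∈) x∈ (begin
    iter σ i (iter σ (j ∸ i) x)  ≡⟨ iter-+ σ i (j ∸ i) x ⟨
    iter σ (i + (j ∸ i)) x       ≡⟨ cong (λ t → iter σ t x) (ℕP.m+[n∸m]≡n (ℕP.<⇒≤ i<j)) ⟩
    iter σ j x                   ≡⟨ σⁱx≡σʲx ⟨
    iter σ i x                   ∎)
  where open ≡-Reasoning

CycleMin : (ℤ → ℤ) → ℤ → Set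
CycleMin σ x = ∀ k → x ℤ.≤ iter σ k x

allB-sound : ∀ f ks → T (allB f ks) → ∀ {k} → k ∈ ks → T (f k)
allB-sound f (k ∷ ks) t k∈ with f k in fk
allB-sound f (k ∷ ks) t (here refl) | true = subst T (sym fk) tt
allB-sound f (k ∷ ks) t (there k∈)  | true = allB-sound f ks t k∈

allB-complete : ∀ f ks → (∀ {k} → k ∈ ks → T (f k)) → T (allB f ks)
allB-complete f []       h = tt
allB-complete f (k ∷ ks) h with f k | h (here refl)
... | true | _ = allB-complete f ks (h ∘ there)

-- Checking σᵏ x for k < m suffices, because some period of x is at most m.
isCycleMin-sound : ∀ σ m x → PeriodAtMost σ m x → T (isCycleMin σ m x) → CycleMin σ x
isCycleMin-sound σ m x (suc P , _ , ℓ≤m , e) t k =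
  subst (x ℤ.≤_) (sym (iter-%-period σ P x e k))
    (ℤP.≤ᵇ⇒≤ (allB-sound _ (upTo m) t (∈-upTo⁺ (ℕP.<-≤-trans (ℕD.m%n<n k (suc P)) ℓ≤m))))

isCycleMin-complete : ∀ σ m x → CycleMin σ x → T (isCycleMin σ m x)
isCycleMin-complete σ m x min = allB-complete _ (upTo m) (λ {k} _ → ℤP.≤⇒≤ᵇ (min k))

CycleMin-of-orbit : ∀ σ P x → iter σ (suc P) x ≡ x → ∀ j →
  (∀ r → r ℕ.< suc P → iter σ j x ℤ.≤ iter σ r x) → CycleMin σ (iter σ j x)
CycleMin-of-orbit σ P x e j least k =
  subst (iter σ j x ℤ.≤_)
    (sym (trans (sym (iter-+ σ k j x)) (iter-%-period σ P x e (k + j))))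
    (least _ (ℕD.m%n<n (k + j) (suc P)))

CycleMin-≤-orbit : ∀ σ P x → iter σ P x ≡ x → ∀ j → j ℕ.≤ P → CycleMin σ (iter σ j x) →
  ∀ r → iter σ j x ℤ.≤ iter σ r x
CycleMin-≤-orbit σ P x e j j≤P min r =
  subst (iter σ j x ℤ.≤_) (iter-∸-period σ P x e j≤P r) (min (r + (P ∸ j)))

argmin-below : ∀ (c : ℕ → ℤ) P → ∃[ i ] (i ℕ.< suc P × ∀ r → r ℕ.< suc P → c i ℤ.≤ c r)
argmin-below c P =
  i , [ (λ i≡0 → subst (ℕ._< suc P) (sym i≡0) (s≤s z≤n)) , ∈-upTo⁻ ]′ (ℤExtrema.argmin-sel c 0 (upTo (suc P))) ,
  λ r r<sP → All.lookup (ℤExtrema.f[argmin]≤f[xs] {f = c} 0 (upTo (suc P))) (∈-upTo⁺ r<sP)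
  where i = ℤExtrema.argmin c 0 (upTo (suc P))

least-witness : {P : ℕ → Set} → Decidable P → ∀ {n} → P n → ∃[ m ] (P m × ∀ k → k ℕ.< m → ¬ P k)
least-witness {P} P? {n} Pn with search (suc n)
  where
  search : ∀ b → ∃[ m ] (P m × m ℕ.< b × ∀ k → k ℕ.< m → ¬ P k) ⊎ (∀ k → k ℕ.< b → ¬ P k)
  search zero = inj₂ (λ k ())
  search (suc b) with search b
  ... | inj₁ (m , Pm , m<b , below) = inj₁ (m , Pm , ℕP.m≤n⇒m≤1+n m<b , below)
  ... | inj₂ none with P? b
  ...   | yes Pb = inj₁ (b , Pb , ℕP.≤-refl , none)
  ...   | no ¬Pb = inj₂ λ k k<sb → [ none k , (λ { refl → ¬Pb }) ]′ (ℕP.m≤n⇒m<n∨m≡n (ℕP.≤-pred k<sb))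
... | inj₁ (m , Pm , _ , below) = m , Pm , below
... | inj₂ none = ⊥-elim (none n ℕP.≤-refl Pn)

-- Going k steps backwards along a cycle of period ℓ is going k ℓ - k steps forwards.
module RightInverseOn (σ τ : ℤ → ℤ) (P : ℤ → Set)
  (τ-closed : ∀ {y} → P y → P (τ y)) (σ∘τ≗id : ∀ {y} → P y → σ (τ y) ≡ y)
  (σ-periodic : ∀ {y} → P y → Periodic σ y) (τ-periodic : ∀ {y} → P y → Periodic τ y) where

  iter-τ-closed : ∀ k {x} → P x → P (iter τ k x)
  iter-τ-closed zero    Px = Px
  iter-τ-closed (suc k) Px = τ-closed (iter-τ-closed k Px)

  iter-σ∘iter-τ : ∀ k {x} → P x → iter σ k (iter τ k x) ≡ x
  iter-σ∘iter-τ zero    Px = refl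
  iter-σ∘iter-τ (suc k) {x} Px = begin
      σ (iter σ k (τ (iter τ k x)))   ≡⟨ sym (iter-comm σ k _) ⟩
      iter σ k (σ (τ (iter τ k x)))   ≡⟨ cong (iter σ k) (σ∘τ≗id (iter-τ-closed k Px)) ⟩
      iter σ k (iter τ k x)           ≡⟨ iter-σ∘iter-τ k Px ⟩
      x                               ∎
    where open ≡-Reasoning

  CycleMin-σ⇒τ : ∀ {x} → P x → CycleMin σ x → CycleMin τ x
  CycleMin-σ⇒τ {x} Px min k with ℓ , ℓ≥1 , e ← σ-periodic (iter-τ-closed k Px) =
    subst (x ℤ.≤_) σ-reaches (min (k * ℓ ∸ k))
    where
    open ≡-Reasoning
    y = iter τ k x
    k≤k*ℓ = ℕP.m≤m*n k ℓ ⦃ ℕ.>-nonZero ℓ≥1 ⦄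
    σ-reaches : iter σ (k * ℓ ∸ k) x ≡ y
    σ-reaches = begin
        iter σ (k * ℓ ∸ k) x             ≡⟨ cong (iter σ (k * ℓ ∸ k)) (sym (iter-σ∘iter-τ k Px)) ⟩
        iter σ (k * ℓ ∸ k) (iter σ k y)  ≡⟨ sym (iter-+ σ (k * ℓ ∸ k) k y) ⟩
        iter σ (k * ℓ ∸ k + k) y         ≡⟨ cong (λ t → iter σ t y) (ℕP.m∸n+n≡m k≤k*ℓ) ⟩
        iter σ (k * ℓ) y                 ≡⟨ iter-*-period σ ℓ y e k ⟩
        y                                ∎

  CycleMin-τ⇒σ : ∀ {x} → P x → CycleMin τ x → CycleMin σ x
  CycleMin-τ⇒σ {x} Px min j with ℓ , ℓ≥1 , e ← τ-periodic Px =
    subst (x ℤ.≤_) (sym σ-reaches) (min (j * ℓ ∸ j))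
    where
    z = iter τ (j * ℓ ∸ j) x
    τ-returns : iter τ j z ≡ x
    τ-returns = trans (sym (iter-+ τ j _ x))
      (trans (cong (λ t → iter τ t x) (ℕP.m+[n∸m]≡n (ℕP.m≤m*n j ℓ ⦃ ℕ.>-nonZero ℓ≥1 ⦄)))
             (iter-*-period τ ℓ x e j))
    σ-reaches : iter σ j x ≡ z
    σ-reaches = trans (cong (iter σ j) (sym τ-returns)) (iter-σ∘iter-τ j (iter-τ-closed (j * ℓ ∸ j) Px))

-- Counting

T-⇔⇒≡ : ∀ {b c} → (T b → T c) → (T c → T b) → b ≡ c
T-⇔⇒≡ {true}  {true}  _ _ = refl
T-⇔⇒≡ {true}  {false} f _ = ⊥-elim (f _)
T-⇔⇒≡ {false} {true}  _ g = ⊥-elim (g _)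
T-⇔⇒≡ {false} {false} _ _ = refl

count : {A : Set} → (A → Bool) → List A → ℕ
count f []       = 0
count f (x ∷ xs) = if f x then suc (count f xs) else count f xs

module _ {A : Set} where

  length-filter-T? : ∀ (f : A → Bool) xs → length (filter (λ x → 𝔹P.T? (f x)) xs) ≡ count f xs
  length-filter-T? f []       = refl
  length-filter-T? f (x ∷ xs) with f x
  ... | true  = cong suc (length-filter-T? f xs)
  ... | false = length-filter-T? f xs

  count-split : ∀ (f g : A → Bool) xs →
    count f xs ≡ count (λ x → f x ∧ g x) xs + count (λ x → f x ∧ not (g x)) xs
  count-split f g []       = refl
  count-split f g (x ∷ xs) with f x | g x
  ... | true  | true  = cong suc (count-split f g xs)
  ... | true  | false = trans (cong suc (count-split f g xs)) (sym (ℕP.+-suc _ _))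
  ... | false | _     = count-split f g xs

  count-cong : ∀ (f h : A → Bool) xs → (∀ {x} → x ∈ xs → f x ≡ h x) → count f xs ≡ count h xs
  count-cong f h []       f≗h = refl
  count-cong f h (x ∷ xs) f≗h rewrite f≗h (here refl) with h x
  ... | true  = cong suc (count-cong f h xs (f≗h ∘ there))
  ... | false = count-cong f h xs (f≗h ∘ there)

  count-none : ∀ (f : A → Bool) xs → (∀ {x} → x ∈ xs → f x ≡ false) → count f xs ≡ 0
  count-none f []       none = refl
  count-none f (x ∷ xs) none rewrite none (here refl) = count-none f xs (none ∘ there)

  count-unique : ∀ (f : A → Bool) {xs} w → Unique xs → w ∈ xs →
    (∀ {x} → x ∈ xs → T (f x) → x ≡ w) → T (f w) → count f xs ≡ 1
  count-unique f {x ∷ xs} w (x∉xs ∷ _) (here refl) only fw with f w | fw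
  ... | true | _ = cong suc (count-none f xs none)
    where
    none : ∀ {y} → y ∈ xs → f y ≡ false
    none {y} y∈ with f y in fy
    ... | false = refl
    ... | true  = ⊥-elim (All.lookup x∉xs y∈ (sym (only (there y∈) (subst T (sym fy) tt))))
  count-unique f {x ∷ xs} w (x∉xs ∷ u) (there w∈) only fw with f x in fx
  ... | true  = ⊥-elim (All.lookup x∉xs w∈ (only (here refl) (subst T (sym fx) tt)))
  ... | false = count-unique f w u w∈ (only ∘ there) fw

-- Cycles and products of transpositions given by lists

Unique-prefix : ∀ (xs : List ℤ) {x ys} → Unique (xs ++ x ∷ ys) → x ∉ xs
Unique-prefix (w ∷ xs) (w∉ ∷ _) (here refl) = All.lookup w∉ (∈-++⁺ʳ xs (here refl)) refl
Unique-prefix (w ∷ xs) (_ ∷ u)  (there x∈)  = Unique-prefix xs u x∈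

Unique-reverse : ∀ {xs : List ℤ} → Unique xs → Unique (reverse xs)
Unique-reverse {[]}     u          = []
Unique-reverse {x ∷ xs} (x∉ ∷ u) rewrite ListP.unfold-reverse x xs =
  UniqueP.++⁺ (Unique-reverse u) ([] ∷ []) λ { (x∈ , here refl) → All.lookup x∉ (reverse⁻ x∈) refl }

Adjacent : List ℤ → ℤ → ℤ → Set
Adjacent L x y = ∃[ xs ] ∃[ ys ] (L ≡ xs ++ x ∷ y ∷ ys)

Adjacent-++ʳ : ∀ {L x y} R → Adjacent L x y → Adjacent (L ++ R) x y
Adjacent-++ʳ R (xs , ys , refl) = xs , ys ++ R , ListP.++-assoc xs (_ ∷ _ ∷ ys) R

Adjacent-++ˡ : ∀ {L x y} R → Adjacent L x y → Adjacent (R ++ L) x y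
Adjacent-++ˡ R (xs , ys , refl) = R ++ xs , ys , sym (ListP.++-assoc R xs _)

Adjacent-map : ∀ (f : ℤ → ℤ) {L x y} → Adjacent L x y → Adjacent (map f L) (f x) (f y)
Adjacent-map f (xs , ys , refl) = map f xs , map f ys , ListP.map-++ f xs _

Adjacent-reverse : ∀ {L x y} → Adjacent L x y → Adjacent (reverse L) y x
Adjacent-reverse {x = x} {y} (xs , ys , refl) = reverse ys , reverse xs , (begin
    reverse (xs ++ x ∷ y ∷ ys)                       ≡⟨ ListP.reverse-++ xs (x ∷ y ∷ ys) ⟩
    reverse (x ∷ y ∷ ys) ++ reverse xs               ≡⟨ cong (_++ reverse xs) (ListP.reverse-++ [ x ] (y ∷ ys)) ⟩
    (reverse (y ∷ ys) ++ [ x ]) ++ reverse xs        ≡⟨ ListP.++-assoc (reverse (y ∷ ys)) [ x ] (reverse xs) ⟩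
    reverse (y ∷ ys) ++ x ∷ reverse xs               ≡⟨ cong (_++ x ∷ reverse xs) (ListP.unfold-reverse y ys) ⟩
    (reverse ys ++ [ y ]) ++ x ∷ reverse xs          ≡⟨ ListP.++-assoc (reverse ys) [ y ] (x ∷ reverse xs) ⟩
    reverse ys ++ y ∷ x ∷ reverse xs                 ∎)
  where open ≡-Reasoning

cyclePerm-skip : ∀ {c₀ w d x} cs → x ≢ c₀ → x ≢ w →
  cyclePerm (c₀ ∷ w ∷ d ∷ cs) x ≡ cyclePerm (c₀ ∷ d ∷ cs) x
cyclePerm-skip {c₀} {w} {x = x} cs x≢c₀ x≢w with x ≟ c₀ | x ≟ w
... | yes x≡c₀ | _       = ⊥-elim (x≢c₀ x≡c₀)
... | no _     | yes x≡w = ⊥-elim (x≢w x≡w)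
... | no _     | no _    = refl

cyclePerm-head : ∀ x y ys → cyclePerm (x ∷ y ∷ ys) x ≡ y
cyclePerm-head x y ys with x ≟ x
... | yes _  = refl
... | no x≢x = ⊥-elim (x≢x refl)

cyclePerm-rotate : ∀ c₀ x ys → x ≢ c₀ → cyclePerm (c₀ ∷ x ∷ ys) x ≡ cyclePerm (x ∷ ys ++ [ c₀ ]) x
cyclePerm-rotate c₀ x [] x≢c₀ with x ≟ c₀ | x ≟ x
... | yes x≡c₀ | _      = ⊥-elim (x≢c₀ x≡c₀)
... | no _     | yes _  = refl
... | no _     | no x≢x = ⊥-elim (x≢x refl)
cyclePerm-rotate c₀ x (y ∷ ys) x≢c₀ with x ≟ c₀ | x ≟ x
... | yes x≡c₀ | _      = ⊥-elim (x≢c₀ x≡c₀)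
... | no _     | yes _  = refl
... | no _     | no x≢x = ⊥-elim (x≢x refl)

cyclePerm-skip′ : ∀ c₀ w xs x zs → x ≢ c₀ → x ≢ w →
  cyclePerm (c₀ ∷ w ∷ xs ++ x ∷ zs) x ≡ cyclePerm (c₀ ∷ xs ++ x ∷ zs) x
cyclePerm-skip′ c₀ w []       x zs = cyclePerm-skip zs
cyclePerm-skip′ c₀ w (d ∷ xs) x zs = cyclePerm-skip (xs ++ x ∷ zs)

cyclePerm-next : ∀ xs x y ys → x ∉ xs → cyclePerm (xs ++ x ∷ y ∷ ys) x ≡ y
cyclePerm-next []             x y ys x∉ = cyclePerm-head x y ys
cyclePerm-next (c₀ ∷ [])      x y ys x∉ =
  trans (cyclePerm-rotate c₀ x (y ∷ ys) (x∉ ∘ here)) (cyclePerm-head x y (ys ++ [ c₀ ]))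
cyclePerm-next (c₀ ∷ w ∷ xs) x y ys x∉ =
  trans (cyclePerm-skip′ c₀ w xs x (y ∷ ys) (x∉ ∘ here) (x∉ ∘ there ∘ here))
        (cyclePerm-next (c₀ ∷ xs) x y ys λ { (here x≡c₀) → x∉ (here x≡c₀) ; (there x∈) → x∉ (there (there x∈)) })

cyclePerm-last : ∀ c₀ xs x → x ∉ c₀ ∷ xs → cyclePerm (c₀ ∷ xs ++ [ x ]) x ≡ c₀
cyclePerm-last c₀ []       x x∉ = trans (cyclePerm-rotate c₀ x [] (x∉ ∘ here)) (cyclePerm-head x c₀ [])
cyclePerm-last c₀ (w ∷ xs) x x∉ =
  trans (cyclePerm-skip′ c₀ w xs x [] (x∉ ∘ here) (x∉ ∘ there ∘ here))
        (cyclePerm-last c₀ xs x λ { (here x≡c₀) → x∉ (here x≡c₀) ; (there x∈) → x∉ (there (there x∈)) })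

cyclePerm-singleton : ∀ c → cyclePerm [ c ] c ≡ c
cyclePerm-singleton c with c ≟ c
... | yes _ = refl
... | no _  = refl

cyclePerm-Adjacent : ∀ {L x y} → Unique L → Adjacent L x y → cyclePerm L x ≡ y
cyclePerm-Adjacent u (xs , ys , refl) = cyclePerm-next xs _ _ ys (Unique-prefix xs u)

cyclePerm-Last : ∀ {L} c₀ xs {x} → Unique L → L ≡ c₀ ∷ xs ++ [ x ] → cyclePerm L x ≡ c₀
cyclePerm-Last c₀ xs {x} u refl = cyclePerm-last c₀ xs x (Unique-prefix (c₀ ∷ xs) u)

entries : List (ℤ × ℤ) → List ℤ
entries []             = []
entries ((x , y) ∷ ps) = x ∷ y ∷ entries ps

fst∈entries : ∀ {ps x y} → (x , y) ∈ ps → x ∈ entries ps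
fst∈entries {_ ∷ ps} (here refl) = here refl
fst∈entries {_ ∷ ps} (there p)   = there (there (fst∈entries p))

snd∈entries : ∀ {ps x y} → (x , y) ∈ ps → y ∈ entries ps
snd∈entries {_ ∷ ps} (here refl) = there (here refl)
snd∈entries {_ ∷ ps} (there p)   = there (there (snd∈entries p))

∈entries⁻ : ∀ {ps z} → z ∈ entries ps → ∃[ y ] ((z , y) ∈ ps ⊎ (y , z) ∈ ps)
∈entries⁻ {(x , y) ∷ ps} (here refl)         = y , inj₁ (here refl)
∈entries⁻ {(x , y) ∷ ps} (there (here refl)) = x , inj₂ (here refl)
∈entries⁻ {(x , y) ∷ ps} (there (there z∈)) with ∈entries⁻ z∈
... | w , inj₁ p = w , inj₁ (there p)
... | w , inj₂ p = w , inj₂ (there p)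

transpositions-skip : ∀ x y ps z → z ≢ x → z ≢ y → transpositions ((x , y) ∷ ps) z ≡ transpositions ps z
transpositions-skip x y ps z z≢x z≢y with z ≟ x | z ≟ y
... | yes z≡x | _       = ⊥-elim (z≢x z≡x)
... | no _    | yes z≡y = ⊥-elim (z≢y z≡y)
... | no _    | no _    = refl

transpositions-fst : ∀ ps {x y} → Unique (entries ps) → (x , y) ∈ ps → transpositions ps x ≡ y
transpositions-fst ((x , y) ∷ ps) _ (here refl) with x ≟ x
... | yes _  = refl
... | no x≢x = ⊥-elim (x≢x refl)
transpositions-fst ((x′ , y′) ∷ ps) {x} (x′∉ ∷ y′∉ ∷ u) (there p) =
  trans (transpositions-skip x′ y′ ps x (λ e → All.lookup x′∉ (there (fst∈entries p)) (sym e))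
                                       (λ e → All.lookup y′∉ (fst∈entries p) (sym e)))
        (transpositions-fst ps u p)

transpositions-snd : ∀ ps {x y} → Unique (entries ps) → (x , y) ∈ ps → transpositions ps y ≡ x
transpositions-snd ((x , y) ∷ ps) (x∉ ∷ _) (here refl) with y ≟ x | y ≟ y
... | yes y≡x | _      = ⊥-elim (All.lookup x∉ (here refl) (sym y≡x))
... | no _    | yes _  = refl
... | no _    | no y≢y = ⊥-elim (y≢y refl)
transpositions-snd ((x′ , y′) ∷ ps) {y = y} (x′∉ ∷ y′∉ ∷ u) (there p) =
  trans (transpositions-skip x′ y′ ps y (λ e → All.lookup x′∉ (there (snd∈entries p)) (sym e))
                                       (λ e → All.lookup y′∉ (snd∈entries p) (sym e)))
        (transpositions-snd ps u p)

-- Cycles of σ on D versus those of a rerouting τ of σ⁻¹ through a new least point M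

parity : ∀ n → ∃[ m ] (n ≡ m + m ⊎ n ≡ suc (m + m))
parity zero = 0 , inj₁ refl
parity (suc n) with parity n
... | m , inj₁ n≡2m  = m , inj₂ (cong suc n≡2m)
... | m , inj₂ n≡2m+1 = suc m , inj₁ (trans (cong suc n≡2m+1) (cong suc (sym (ℕP.+-suc m m))))

split-index : ∀ m {i} → i ℕ.< suc (m + m) →
  i ≡ 0 ⊎ (∃[ t ] (t ℕ.< m × t + i ≡ m)) ⊎ (∃[ t ] (t ℕ.< m × t + i ≡ m + m))
split-index m {zero}  _ = inj₁ refl
split-index m {suc i} i<2m+1 with suc i ℕ.≤? m
... | yes i≤m = inj₂ (inj₁ (m ∸ suc i , ℕP.∸-monoʳ-< (s≤s z≤n) i≤m , ℕP.m∸n+n≡m i≤m))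
... | no i≰m  = inj₂ (inj₂ (m + m ∸ suc i ,
  subst (m + m ∸ suc i ℕ.<_) (ℕP.m+n∸n≡m m m) (ℕP.∸-monoʳ-< (ℕP.≰⇒> i≰m) i≤2m) , ℕP.m∸n+n≡m i≤2m))
  where i≤2m = ℕP.≤-pred i<2m+1

module CycleCounts (D : List ℤ) (M : ℤ) (σ τ : ℤ → ℤ)
  (D-unique : Unique D) (M<D : ∀ {x} → x ∈ D → M ℤ.< x)
  (σ-closed : Closed σ D) (σ-injective : InjectiveOn σ D)
  (τ-closed : Closed τ (M ∷ D)) (τ-injective : InjectiveOn τ (M ∷ D)) where

  Fσ : ℤ → Bool
  Fσ = isCycleMin σ (length D)

  Fτ : ℤ → Bool
  Fτ = isCycleMin τ (length (M ∷ D))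

  M∉D : M ∉ D
  M∉D M∈D = ℤP.<-irrefl refl (M<D M∈D)

  M≤E : ∀ {x} → x ∈ M ∷ D → M ℤ.≤ x
  M≤E (here refl)  = ℤP.≤-refl
  M≤E (there x∈D) = ℤP.<⇒≤ (M<D x∈D)

  σ-periodic : ∀ {x} → x ∈ D → Periodic σ x
  σ-periodic = periodAtMost⇒periodic ∘ periodAtMost-length σ-closed σ-injective

  τ-periodic : ∀ {x} → x ∈ M ∷ D → Periodic τ x
  τ-periodic = periodAtMost⇒periodic ∘ periodAtMost-length τ-closed τ-injective

  Fσ-sound : ∀ {x} → x ∈ D → T (Fσ x) → CycleMin σ x
  Fσ-sound x∈ = isCycleMin-sound σ _ _ (periodAtMost-length σ-closed σ-injective x∈)

  Fτ-sound : ∀ {x} → x ∈ M ∷ D → T (Fτ x) → CycleMin τ x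
  Fτ-sound x∈ = isCycleMin-sound τ _ _ (periodAtMost-length τ-closed τ-injective x∈)

  Fσ-complete : ∀ {x} → CycleMin σ x → T (Fσ x)
  Fσ-complete = isCycleMin-complete σ (length D) _

  Fτ-complete : ∀ {x} → CycleMin τ x → T (Fτ x)
  Fτ-complete = isCycleMin-complete τ (length (M ∷ D)) _

  count-Fτ-M∷D : count Fτ (M ∷ D) ≡ suc (count Fτ D)
  count-Fτ-M∷D with Fτ M in FτM
  ... | true  = refl
  ... | false = ⊥-elim (subst T FτM (Fτ-complete (λ k → M≤E (iter-closed τ-closed k (here refl)))))

  τ-closed-off : ∀ {y u} → y ∈ D → u ∈ M ∷ D → τ u ≡ M → y ≢ u → τ y ∈ D
  τ-closed-off y∈ u∈ τu≡M y≢u with τ-closed (there y∈)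
  ... | here τy≡M = ⊥-elim (y≢u (τ-injective (there y∈) u∈ (trans τy≡M (sym τu≡M))))
  ... | there τy∈ = τy∈

  Fτ≡Fσ-on : (P : ℤ → Set) → (∀ {y} → P y → y ∈ D) → (∀ {y} → P y → P (τ y)) →
    (∀ {y} → P y → σ (τ y) ≡ y) → ∀ {x} → P x → Fτ x ≡ Fσ x
  Fτ≡Fσ-on P P⇒D P-closed σ∘τ≗id Px =
    T-⇔⇒≡ (λ t → Fσ-complete (CycleMin-τ⇒σ Px (Fτ-sound (there (P⇒D Px)) t)))
          (λ t → Fτ-complete (CycleMin-σ⇒τ Px (Fσ-sound (P⇒D Px) t)))
    where
    open RightInverseOn σ τ P P-closed σ∘τ≗id (σ-periodic ∘ P⇒D) (τ-periodic ∘ there ∘ P⇒D)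

  count-τ-inverse : τ M ≡ M → (∀ {y} → y ∈ D → σ (τ y) ≡ y) → count Fτ (M ∷ D) ≡ suc (count Fσ D)
  count-τ-inverse τM≡M σ∘τ≗id =
    trans count-Fτ-M∷D (cong suc (count-cong Fτ Fσ D (Fτ≡Fσ-on (_∈ D) (λ y∈ → y∈) τ-closed-D σ∘τ≗id)))
    where
    τ-closed-D : ∀ {y} → y ∈ D → τ y ∈ D
    τ-closed-D y∈ = τ-closed-off y∈ (here refl) τM≡M (λ { refl → M∉D y∈ })

  module Orbit {a} (a∈D : a ∈ D) where

    w : ℕ → ℤ
    w k = iter σ k a

    w∈D : ∀ k → w k ∈ D
    w∈D k = iter-closed σ-closed k a∈D

    ReturnsAt : ℕ → Set
    ReturnsAt k = 1 ℕ.≤ k × w k ≡ a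

    returnsAt? : ∀ k → Dec (ReturnsAt k)
    returnsAt? k with 1 ℕ.≤? k | w k ℤ.≟ a
    ... | yes k≥1 | yes wk≡a = yes (k≥1 , wk≡a)
    ... | no k≱1  | _        = no (k≱1 ∘ proj₁)
    ... | _       | no wk≢a  = no (wk≢a ∘ proj₂)

    opaque
      minimal-period : ∃[ L ] (ReturnsAt L × ∀ k → k ℕ.< L → ¬ ReturnsAt k)
      minimal-period with ℓ , ℓ≥1 , wℓ≡a ← σ-periodic a∈D = least-witness returnsAt? (ℓ≥1 , wℓ≡a)

    L : ℕ
    L = proj₁ minimal-period

    L≥1 : 1 ℕ.≤ L
    L≥1 = proj₁ (proj₁ (proj₂ minimal-period))

    w-L : w L ≡ a
    w-L = proj₂ (proj₁ (proj₂ minimal-period))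

    w-injective : ∀ {i j} → i ℕ.< j → j ℕ.< L → w i ≢ w j
    w-injective {i} {j} i<j j<L wi≡wj =
      proj₂ (proj₂ minimal-period) (j ∸ i) (ℕP.≤-<-trans (ℕP.m∸n≤m j i) j<L) (ℕP.m<n⇒0<n∸m i<j ,
        sym (iter-injectiveOn σ-closed σ-injective i a∈D (w∈D (j ∸ i)) (begin
          w i                          ≡⟨ wi≡wj ⟩
          w j                          ≡⟨ cong w (sym (ℕP.m+[n∸m]≡n (ℕP.<⇒≤ i<j))) ⟩
          w (i + (j ∸ i))              ≡⟨ iter-+ σ i (j ∸ i) a ⟩
          iter σ i (w (j ∸ i))         ∎)))
      where open ≡-Reasoning

    -- τ inverts σ except that it sends σ a to M, M to σ⁻¹ v and v to a: the σ-orbit of a,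
    -- with v opposite a, splits into two τ-orbits, one of them through M.
    module Split {v} (m : ℕ) (L≡2m+1 : L ≡ suc (m + m)) (m≥1 : 1 ℕ.≤ m) (w-m+1≡v : w (suc m) ≡ v)
      (τ-σa : τ (σ a) ≡ M) (τ-v : τ v ≡ a) (σ-τ-M : σ (τ M) ≡ v)
      (σ∘τ≗id : ∀ {y} → y ∈ D → y ≢ σ a → y ≢ v → σ (τ y) ≡ y) where

      w-2m+1 : w (suc (m + m)) ≡ a
      w-2m+1 = trans (cong w (sym L≡2m+1)) w-L

      <L : ∀ {i} → i ℕ.≤ m + m → i ℕ.< L
      <L i≤2m = subst (_ ℕ.<_) (sym L≡2m+1) (s≤s i≤2m)

      m+1<L : suc m ℕ.< L
      m+1<L = <L (subst (ℕ._≤ m + m) (ℕP.+-comm m 1) (ℕP.+-monoʳ-≤ m m≥1))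

      τ-into-D : ∀ {y} → y ∈ D → y ≢ σ a → τ y ∈ D
      τ-into-D y∈ = τ-closed-off y∈ (there (σ-closed a∈D)) τ-σa

      τ-M∈D : τ M ∈ D
      τ-M∈D with τ-closed (here refl)
      ... | here τM≡M = ⊥-elim (M∉D (subst (_∈ D)
              (τ-injective (there (σ-closed a∈D)) (here refl) (trans τ-σa (sym τM≡M))) (σ-closed a∈D)))
      ... | there τM∈D = τM∈D

      τ-w : ∀ k → w (suc k) ≢ w 1 → w (suc k) ≢ v → τ (w (suc k)) ≡ w k
      τ-w k ≢σa ≢v = σ-injective (τ-into-D (w∈D (suc k)) ≢σa) (w∈D k) (σ∘τ≗id (w∈D (suc k)) ≢σa ≢v)

      τ-w-inner : ∀ {k} → 1 ℕ.≤ k → suc k ℕ.< L → k ≢ m → τ (w (suc k)) ≡ w k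
      τ-w-inner {k} k≥1 k+1<L k≢m = τ-w k (w-injective (s≤s k≥1) k+1<L ∘ sym) ≢v
        where
        ≢v : w (suc k) ≢ v
        ≢v wk+1≡v with ℕP.<-cmp k m
        ... | tri< k<m _ _ = w-injective (s≤s k<m) m+1<L (trans wk+1≡v (sym w-m+1≡v))
        ... | tri≈ _ k≡m _ = k≢m k≡m
        ... | tri> _ _ m<k = w-injective (s≤s m<k) k+1<L (trans w-m+1≡v (sym wk+1≡v))

      τ-a : τ a ≡ w (m + m)
      τ-a = subst (λ x → τ x ≡ w (m + m)) w-2m+1
        (τ-w (m + m) (w-injective (s≤s z≤n) (<L (ℕP.≤-trans m≥1 (ℕP.m≤m+n m m))) ∘ trans (sym w-2m+1))
                     (a≢v ∘ trans (sym w-2m+1)))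
        where
        a≢v : a ≢ v
        a≢v a≡v = w-injective (s≤s z≤n) m+1<L (trans a≡v (sym w-m+1≡v))

      τ-iter-M : ∀ t {i} → t ℕ.< m → t + i ≡ m → iter τ (suc t) M ≡ w i
      τ-iter-M zero    _ refl = σ-injective τ-M∈D (w∈D m) (trans σ-τ-M (sym w-m+1≡v))
      τ-iter-M (suc t) {i} t+1<m t+1+i≡m =
        trans (cong τ (τ-iter-M t (ℕP.<-trans (ℕP.n<1+n t) t+1<m) (trans (ℕP.+-suc t i) t+1+i≡m)))
              (τ-w-inner i≥1 (<L (ℕP.≤-trans (subst (suc i ℕ.≤_) t+1+i≡m (s≤s (ℕP.m≤n+m i t))) (ℕP.m≤m+n m m)))
                         i≢m)
        where
        i≥1 : 1 ℕ.≤ i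
        i≥1 = ℕP.n≢0⇒n>0 λ { refl → ℕP.<-irrefl (trans (sym (ℕP.+-identityʳ (suc t))) t+1+i≡m) t+1<m }
        i≢m : i ≢ m
        i≢m refl = ℕP.<-irrefl (sym t+1+i≡m) (ℕP.m<n+m i (s≤s z≤n))

      τ-iter-a : ∀ t {i} → t ℕ.< m → t + i ≡ m + m → iter τ (suc t) a ≡ w i
      τ-iter-a zero    _ refl = τ-a
      τ-iter-a (suc t) {i} t+1<m t+1+i≡2m =
        trans (cong τ (τ-iter-a t (ℕP.<-trans (ℕP.n<1+n t) t+1<m) (trans (ℕP.+-suc t i) t+1+i≡2m)))
              (τ-w-inner (ℕP.≤-trans m≥1 (ℕP.<⇒≤ m<i))
                         (<L (subst (suc i ℕ.≤_) t+1+i≡2m (s≤s (ℕP.m≤n+m i t))))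
                         (ℕP.<⇒≢ m<i ∘ sym))
        where
        m<i : m ℕ.< i
        m<i = ℕP.≰⇒> λ i≤m → ℕP.<-irrefl t+1+i≡2m (ℕP.+-mono-<-≤ t+1<m i≤m)

      m′ : ℕ
      m′ = ℕ.pred m

      m′+1≡m : suc m′ ≡ m
      m′+1≡m = ℕP.suc-pred m ⦃ ℕ.>-nonZero m≥1 ⦄

      m′<m : m′ ℕ.< m
      m′<m = subst (m′ ℕ.<_) m′+1≡m ℕP.≤-refl

      τ-period-M : iter τ (suc m) M ≡ M
      τ-period-M = begin
          iter τ (suc m) M        ≡⟨ cong (λ t → iter τ (suc t) M) (sym m′+1≡m) ⟩
          τ (iter τ (suc m′) M)   ≡⟨ cong τ (τ-iter-M m′ m′<m (trans (ℕP.+-comm m′ 1) m′+1≡m)) ⟩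
          τ (σ a)                 ≡⟨ τ-σa ⟩
          M                       ∎
        where open ≡-Reasoning

      τ-period-a : iter τ (suc m) a ≡ a
      τ-period-a = begin
          iter τ (suc m) a        ≡⟨ cong (λ t → iter τ (suc t) a) (sym m′+1≡m) ⟩
          τ (iter τ (suc m′) a)   ≡⟨ cong τ (τ-iter-a m′ m′<m m′+m+1≡2m) ⟩
          τ (w (suc m))           ≡⟨ cong τ w-m+1≡v ⟩
          τ v                     ≡⟨ τ-v ⟩
          a                       ∎
        where
        open ≡-Reasoning
        m′+m+1≡2m : m′ + suc m ≡ m + m
        m′+m+1≡2m = trans (ℕP.+-suc m′ m) (cong (ℕ._+ m) m′+1≡m)

      W : List ℤ
      W = map w (upTo L)

      inW : ℤ → Bool
      inW x = does (x ∈? W)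

      ∈W⁻ : ∀ {x} → x ∈ W → ∃[ i ] (i ℕ.< L × x ≡ w i)
      ∈W⁻ x∈W with i , i∈ , x≡wi ← ∈-map⁻ w x∈W = i , ∈-upTo⁻ i∈ , x≡wi

      ∈W⁺ : ∀ {i} → i ℕ.< L → w i ∈ W
      ∈W⁺ = ∈-map⁺ w ∘ ∈-upTo⁺

      T-inW⁻ : ∀ {x} → T (inW x) → x ∈ W
      T-inW⁻ {x} t with x ∈? W
      ... | yes x∈W = x∈W

      T-inW⁺ : ∀ {x} → x ∈ W → T (inW x)
      T-inW⁺ {x} x∈W with x ∈? W
      ... | yes _   = _
      ... | no x∉W = x∉W x∈W

      w-suc∈W : ∀ {i} → i ℕ.< L → w (suc i) ∈ W
      w-suc∈W {i} i<L with ℕP.m≤n⇒m<n∨m≡n i<L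
      ... | inj₁ i+1<L = ∈W⁺ i+1<L
      ... | inj₂ i+1≡L = subst (_∈ W) (sym (trans (cong w i+1≡L) w-L)) (∈W⁺ L≥1)

      OffOrbit : ℤ → Set
      OffOrbit y = y ∈ D × y ∉ W

      σ∘τ≗id-off : ∀ {y} → OffOrbit y → σ (τ y) ≡ y
      σ∘τ≗id-off (y∈D , y∉W) = σ∘τ≗id y∈D (λ { refl → y∉W (∈W⁺ (<L (ℕP.≤-trans m≥1 (ℕP.m≤m+n m m)))) })
                                           (λ { refl → y∉W (subst (_∈ W) w-m+1≡v (∈W⁺ m+1<L)) })

      τ-closed-off-orbit : ∀ {y} → OffOrbit y → OffOrbit (τ y)
      τ-closed-off-orbit {y} (y∈D , y∉W) =
        τ-into-D y∈D (λ { refl → y∉W (∈W⁺ (<L (ℕP.≤-trans m≥1 (ℕP.m≤m+n m m)))) }) , τy∉W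
        where
        τy∉W : τ y ∉ W
        τy∉W τy∈W with i , i<L , τy≡wi ← ∈W⁻ τy∈W =
          y∉W (subst (_∈ W) (trans (cong σ (sym τy≡wi)) (σ∘τ≗id-off (y∈D , y∉W))) (w-suc∈W i<L))

      Fτ≡Fσ-off-orbit : ∀ {x} → x ∈ D → (Fτ x ∧ not (inW x)) ≡ (Fσ x ∧ not (inW x))
      Fτ≡Fσ-off-orbit {x} x∈D with x ∈? W
      ... | yes _   = trans (𝔹P.∧-zeroʳ (Fτ x)) (sym (𝔹P.∧-zeroʳ (Fσ x)))
      ... | no x∉W = trans (𝔹P.∧-identityʳ (Fτ x)) (trans
          (Fτ≡Fσ-on OffOrbit proj₁ τ-closed-off-orbit σ∘τ≗id-off (x∈D , x∉W))
          (sym (𝔹P.∧-identityʳ (Fσ x))))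

      count-Fσ-W : count (λ x → Fσ x ∧ inW x) D ≡ 1
      count-Fσ-W with i , i<2m+1 , least ← argmin-below w (m + m) =
        count-unique _ (w i) D-unique (w∈D i) only (Equivalence.from 𝔹P.T-∧
          (Fσ-complete (CycleMin-of-orbit σ (m + m) a w-2m+1 i least) , T-inW⁺ (∈W⁺ (<L (ℕP.≤-pred i<2m+1)))))
        where
        only : ∀ {x} → x ∈ D → T (Fσ x ∧ inW x) → x ≡ w i
        only {x} x∈D t
          with Fσx , inWx ← Equivalence.to (𝔹P.T-∧ {Fσ x} {inW x}) t
          with j , j<L , refl ← ∈W⁻ (T-inW⁻ inWx) =
          ℤP.≤-antisym (CycleMin-≤-orbit σ L a w-L j (ℕP.<⇒≤ j<L) (Fσ-sound x∈D Fσx) i)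
                       (least j (subst (j ℕ.<_) L≡2m+1 j<L))

      τ-argmin : ∃[ j ] (j ℕ.< suc m × ∀ r → r ℕ.< suc m → iter τ j a ℤ.≤ iter τ r a)
      τ-argmin = argmin-below (λ k → iter τ k a) m

      z : ℤ
      z = iter τ (proj₁ τ-argmin) a

      z-least : ∀ r → r ℕ.< suc m → z ℤ.≤ iter τ r a
      z-least = proj₂ (proj₂ τ-argmin)

      z∈W : z ∈ W
      z∈W with proj₁ τ-argmin | proj₁ (proj₂ τ-argmin)
      ... | zero  | _         = ∈W⁺ L≥1
      ... | suc t | s≤s t<m = subst (_∈ W) (sym (τ-iter-a t t<m (ℕP.m+[n∸m]≡n t≤2m)))
                                 (∈W⁺ (<L (ℕP.m∸n≤m (m + m) t)))
        where t≤2m = ℕP.≤-trans (ℕP.<⇒≤ t<m) (ℕP.m≤m+n m m)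

      -- w i lies on the τ-cycle of a (i = 0 or i > m) or on that of M (1 ≤ i ≤ m), where M < w i.
      CycleMin-τ-w : ∀ {i} → i ℕ.< L → CycleMin τ (w i) → w i ≡ z
      CycleMin-τ-w {i} i<L min with split-index m (subst (i ℕ.<_) L≡2m+1 i<L)
      ... | inj₁ refl = ℤP.≤-antisym (CycleMin-≤-orbit τ (suc m) a τ-period-a 0 z≤n min (proj₁ τ-argmin))
                                     (z-least 0 (s≤s z≤n))
      ... | inj₂ (inj₁ (t , t<m , t+i≡m)) = ⊥-elim (ℤP.<⇒≱ (M<D (w∈D i)) (subst (w i ℤ.≤_) τ-returns-M (min i)))
        where
        open ≡-Reasoning
        i+t+1≡m+1 : i + suc t ≡ suc m
        i+t+1≡m+1 = trans (ℕP.+-suc i t) (cong suc (trans (ℕP.+-comm i t) t+i≡m))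
        τ-returns-M : iter τ i (w i) ≡ M
        τ-returns-M = begin
          iter τ i (w i)                ≡⟨ cong (iter τ i) (sym (τ-iter-M t t<m t+i≡m)) ⟩
          iter τ i (iter τ (suc t) M)   ≡⟨ sym (iter-+ τ i (suc t) M) ⟩
          iter τ (i + suc t) M          ≡⟨ cong (λ s → iter τ s M) i+t+1≡m+1 ⟩
          iter τ (suc m) M              ≡⟨ τ-period-M ⟩
          M                             ∎
      ... | inj₂ (inj₂ (t , t<m , t+i≡2m)) rewrite sym (τ-iter-a t t<m t+i≡2m) =
        ℤP.≤-antisym (CycleMin-≤-orbit τ (suc m) a τ-period-a (suc t) (s≤s (ℕP.<⇒≤ t<m)) min (proj₁ τ-argmin))
                     (z-least (suc t) (s≤s t<m))

      count-Fτ-W : count (λ x → Fτ x ∧ inW x) D ≡ 1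
      count-Fτ-W = count-unique _ z D-unique z∈D only (Equivalence.from 𝔹P.T-∧
          (Fτ-complete (CycleMin-of-orbit τ m a τ-period-a (proj₁ τ-argmin) (proj₂ (proj₂ τ-argmin))) , T-inW⁺ z∈W))
        where
        z∈D : z ∈ D
        z∈D with i , _ , z≡wi ← ∈W⁻ z∈W = subst (_∈ D) (sym z≡wi) (w∈D i)
        only : ∀ {x} → x ∈ D → T (Fτ x ∧ inW x) → x ≡ z
        only {x} x∈D t
          with Fτx , inWx ← Equivalence.to (𝔹P.T-∧ {Fτ x} {inW x}) t
          with i , i<L , refl ← ∈W⁻ (T-inW⁻ inWx) =
          CycleMin-τ-w i<L (Fτ-sound (there x∈D) Fτx)

      count-τ-split : count Fτ (M ∷ D) ≡ suc (count Fσ D)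
      count-τ-split = begin
          count Fτ (M ∷ D)
        ≡⟨ count-Fτ-M∷D ⟩
          suc (count Fτ D)
        ≡⟨ cong suc (count-split Fτ inW D) ⟩
          suc (count (λ x → Fτ x ∧ inW x) D + count (λ x → Fτ x ∧ not (inW x)) D)
        ≡⟨ cong suc (cong₂ _+_ (trans count-Fτ-W (sym count-Fσ-W)) (count-cong _ _ D Fτ≡Fσ-off-orbit)) ⟩
          suc (count (λ x → Fσ x ∧ inW x) D + count (λ x → Fσ x ∧ not (inW x)) D)
        ≡⟨ cong suc (sym (count-split Fσ inW D)) ⟩
          suc (count Fσ D)
        ∎
        where open ≡-Reasoning

    -- σJσ = J makes J reverse σ-orbits; as J swaps a and σ a, it reflects the orbit of a about its
    -- middle, which must therefore be a fixed point of J.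
    module Reflected (J : ℤ → ℤ) (J-closed : Closed J D) (σJσ≗J : ∀ {y} → y ∈ D → σ (J (σ y)) ≡ J y)
      {v} (J-fixed : ∀ {x} → x ∈ D → J x ≡ x → x ≡ v) (J-a : J a ≡ σ a)
      (σ≡J : ∀ {y} → y ∈ D → σ y ≡ J y → y ≡ a) (a≢v : a ≢ v) where

      iter-σJσ : ∀ k {y} → y ∈ D → iter σ k (J (iter σ k y)) ≡ J y
      iter-σJσ zero    y∈ = refl
      iter-σJσ (suc k) {y} y∈ = begin
          σ (iter σ k (J (σ (iter σ k y))))   ≡⟨ sym (iter-comm σ k _) ⟩
          iter σ k (σ (J (σ (iter σ k y))))   ≡⟨ cong (iter σ k) (σJσ≗J (iter-closed σ-closed k y∈)) ⟩
          iter σ k (J (iter σ k y))           ≡⟨ iter-σJσ k y∈ ⟩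
          J y                                 ∎
        where open ≡-Reasoning

      J-w : ∀ {k} → k ℕ.≤ L → J (w k) ≡ w (suc L ∸ k)
      J-w {k} k≤L = iter-injectiveOn σ-closed σ-injective k (J-closed (w∈D k)) (w∈D (suc L ∸ k))
        (trans (iter-σJσ k a∈D) (trans J-a (sym (begin
          iter σ k (w (suc L ∸ k))   ≡⟨ sym (iter-+ σ k (suc L ∸ k) a) ⟩
          w (k + (suc L ∸ k))        ≡⟨ cong w (ℕP.m+[n∸m]≡n (ℕP.m≤n⇒m≤1+n k≤L)) ⟩
          σ (w L)                    ≡⟨ cong σ w-L ⟩
          σ a                        ∎))))
        where open ≡-Reasoning

      J-w-complement : ∀ {m k} → L ≡ m + k → J (w k) ≡ w (suc m)
      J-w-complement {m} {k} L≡m+k = trans (J-w (subst (k ℕ.≤_) (sym L≡m+k) (ℕP.m≤n+m k m)))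
        (cong w (trans (cong (λ t → suc t ∸ k) L≡m+k) (ℕP.m+n∸n≡m (suc m) k)))

      orbit-odd : ∃[ m ] (L ≡ suc (m + m) × 1 ℕ.≤ m × w (suc m) ≡ v)
      orbit-odd with parity L
      ... | m , inj₁ L≡2m =
        ⊥-elim (proj₂ (proj₂ minimal-period) m m<L (m≥1 , σ≡J (w∈D m) (sym (J-w-complement {m} {m} L≡2m))))
        where
        m≥1 : 1 ℕ.≤ m
        m≥1 = ℕP.n≢0⇒n>0 λ { refl → ℕP.<-irrefl (sym L≡2m) L≥1 }
        m<L : m ℕ.< L
        m<L = subst (m ℕ.<_) (sym L≡2m) (ℕP.m<m+n m m≥1)
      ... | m , inj₂ L≡2m+1 = m , L≡2m+1 , m≥1 , w-middle≡v
        where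
        w-middle≡v : w (suc m) ≡ v
        w-middle≡v = J-fixed (w∈D (suc m)) (J-w-complement {m} {suc m} (trans L≡2m+1 (sym (ℕP.+-suc m m))))
        m≥1 : 1 ℕ.≤ m
        m≥1 = ℕP.n≢0⇒n>0 λ { refl → a≢v (trans (sym w-L) (trans (cong w L≡2m+1) w-middle≡v)) }

      count-τ-rerouted : τ (σ a) ≡ M → τ v ≡ a → σ (τ M) ≡ v →
        (∀ {y} → y ∈ D → y ≢ σ a → y ≢ v → σ (τ y) ≡ y) → count Fτ (M ∷ D) ≡ suc (count Fσ D)
      count-τ-rerouted τ-σa τ-v σ-τ-M σ∘τ≗id with m , L≡2m+1 , m≥1 , w-m+1≡v ← orbit-odd =
        Split.count-τ-split m L≡2m+1 m≥1 w-m+1≡v τ-σa τ-v σ-τ-M σ∘τ≗id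

-- The signed sets, θ₂ and p

mirror : ℤ → ℤ
mirror (+ i)    = -[1+ i ]
mirror -[1+ i ] = + i

mirror-involutive : ∀ x → mirror (mirror x) ≡ x
mirror-involutive (+ i)    = refl
mirror-involutive -[1+ i ] = refl

mirror-injective : ∀ {x y} → mirror x ≡ mirror y → x ≡ y
mirror-injective {x} {y} e = trans (sym (mirror-involutive x)) (trans (cong mirror e) (mirror-involutive y))

mirror-x≢x : ∀ x → mirror x ≢ x
mirror-x≢x (+ i) ()
mirror-x≢x -[1+ i ] ()

InRange : ℕ → ℤ → Set
InRange n x = ∣ x ∣ ℕ.≤ n

InRange-neg : ∀ {n} x → InRange n x → InRange n (- x)
InRange-neg {n} x = subst (ℕ._≤ n) (sym (ℤP.∣-i∣≡∣i∣ x))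

lowest : ℕ → ℤ
lowest n = -[1+ n ]

lowest<InRange : ∀ {n x} → InRange n x → lowest n ℤ.< x
lowest<InRange {x = + i}      _    = -<+
lowest<InRange {x = -[1+ i ]} i<n = -<- i<n

InRange⇒≢lowest : ∀ {n x} → InRange n x → x ≢ lowest n
InRange⇒≢lowest n<n refl = ℕP.<-irrefl refl n<n

∈-oneToN⁻ : ∀ {n x} → x ∈ oneToN n → ∃[ i ] (i ℕ.< n × x ≡ + suc i)
∈-oneToN⁻ x∈ with i , i∈ , x≡ ← ∈-map⁻ (λ i → + suc i) x∈ = i , ∈-upTo⁻ i∈ , x≡

∈-oneToN⁺ : ∀ {n i} → i ℕ.< n → + suc i ∈ oneToN n
∈-oneToN⁺ = ∈-map⁺ (λ i → + suc i) ∘ ∈-upTo⁺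

oneToN-unique : ∀ n → Unique (oneToN n)
oneToN-unique n = UniqueP.map⁺ (ℕP.suc-injective ∘ ℤP.+-injective) (UniqueP.upTo⁺ n)

oneToN-suc : ∀ n → oneToN (suc n) ≡ oneToN n ++ [ + suc n ]
oneToN-suc n = trans (cong (map (λ i → + suc i)) (sym (ListP.upTo-∷ʳ n))) (ListP.map-++ _ (upTo n) [ n ])

0∉oneToN : ∀ {n} → + 0 ∉ oneToN n
0∉oneToN 0∈ with ∈-oneToN⁻ 0∈
... | _ , _ , ()

neg∉oneToN : ∀ {n i} → -[1+ i ] ∉ oneToN n
neg∉oneToN x∈ with ∈-oneToN⁻ x∈
... | _ , _ , ()

∈-signedSet⁻ : ∀ {n x} → x ∈ signedSet n → InRange n x
∈-signedSet⁻ {n} x∈ with ∈-++⁻ (map -_ (oneToN n)) x∈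
... | inj₁ x∈neg with y , y∈ , refl ← ∈-map⁻ -_ x∈neg with i , i<n , refl ← ∈-oneToN⁻ y∈ = i<n
... | inj₂ (here refl) = z≤n
... | inj₂ (there x∈pos) with i , i<n , refl ← ∈-oneToN⁻ x∈pos = i<n

∈-signedSet⁺ : ∀ {n x} → InRange n x → x ∈ signedSet n
∈-signedSet⁺ {n} {+ zero}    _   = ∈-++⁺ʳ (map -_ (oneToN n)) (here refl)
∈-signedSet⁺ {n} {+ suc i}   i<n = ∈-++⁺ʳ (map -_ (oneToN n)) (there (∈-oneToN⁺ i<n))
∈-signedSet⁺ {n} { -[1+ i ]} i<n = ∈-++⁺ˡ (∈-map⁺ -_ (∈-oneToN⁺ i<n))

signedSet-unique : ∀ n → Unique (signedSet n)
signedSet-unique n = UniqueP.++⁺ (UniqueP.map⁺ ℤP.neg-injective (oneToN-unique n))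
  (All.tabulate (λ x∈ 0≡x → 0∉oneToN (subst (_∈ oneToN n) (sym 0≡x) x∈)) ∷ oneToN-unique n) disjoint
  where
  disjoint : ∀ {x} → ¬ (x ∈ map -_ (oneToN n) × x ∈ + 0 ∷ oneToN n)
  disjoint (x∈neg , x∈pos) with y , y∈ , refl ← ∈-map⁻ -_ x∈neg with i , _ , refl ← ∈-oneToN⁻ y∈ with x∈pos
  ... | there x∈ = neg∉oneToN x∈

∈-signedSetExt⁻ : ∀ {n x} → x ∈ signedSetExt n → x ≡ lowest n ⊎ InRange n x
∈-signedSetExt⁻ (here x≡)  = inj₁ x≡
∈-signedSetExt⁻ (there x∈) = inj₂ (∈-signedSet⁻ x∈)

InRange⇒∈signedSetExt : ∀ {n x} → InRange n x → x ∈ signedSetExt n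
InRange⇒∈signedSetExt = there ∘ ∈-signedSet⁺

∈signedSetExt⇒InRange : ∀ {n x} → x ∈ signedSetExt n → x ≢ lowest n → InRange n x
∈signedSetExt⇒InRange x∈ x≢lowest with ∈-signedSetExt⁻ x∈
... | inj₁ x≡lowest = ⊥-elim (x≢lowest x≡lowest)
... | inj₂ x∈range  = x∈range

mirror-signedSetExt : ∀ {n x} → x ∈ signedSetExt n → mirror x ∈ signedSetExt n
mirror-signedSetExt {n} {x} x∈ with ∈-signedSetExt⁻ x∈
... | inj₁ refl = InRange⇒∈signedSetExt ℕP.≤-refl
mirror-signedSetExt {n} {+ i} x∈ | inj₂ i≤n with i ℕ.≟ n
... | yes refl = here refl
... | no i≢n   = InRange⇒∈signedSetExt (ℕP.≤∧≢⇒< i≤n i≢n)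
mirror-signedSetExt {n} { -[1+ i ]} x∈ | inj₂ i<n = InRange⇒∈signedSetExt (ℕP.<⇒≤ i<n)

θ₂-pairs : List ℕ → List (ℤ × ℤ)
θ₂-pairs = map (λ i → (+ i , - (+ suc i)))

∈-entries-θ₂-pairs⁻ : ∀ {is z} → z ∈ entries (θ₂-pairs is) → ∃[ j ] (j ∈ is × (z ≡ + j ⊎ z ≡ -[1+ j ]))
∈-entries-θ₂-pairs⁻ {i ∷ is} (here refl)         = i , here refl , inj₁ refl
∈-entries-θ₂-pairs⁻ {i ∷ is} (there (here refl)) = i , here refl , inj₂ refl
∈-entries-θ₂-pairs⁻ {i ∷ is} (there (there z∈)) with j , j∈ , z≡ ← ∈-entries-θ₂-pairs⁻ z∈ = j , there j∈ , z≡

entries-θ₂-pairs-unique : ∀ {is} → Unique is → Unique (entries (θ₂-pairs is))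
entries-θ₂-pairs-unique {[]}     _          = []
entries-θ₂-pairs-unique {i ∷ is} (i∉ ∷ u) =
  ((λ ()) ∷ All.tabulate +i∉) ∷ All.tabulate -[1+i]∉ ∷ entries-θ₂-pairs-unique u
  where
  +i∉ : ∀ {z} → z ∈ entries (θ₂-pairs is) → + i ≢ z
  +i∉ z∈ +i≡z with j , j∈ , z≡ ← ∈-entries-θ₂-pairs⁻ z∈ with z≡ | +i≡z
  ... | inj₁ refl | refl = All.lookup i∉ j∈ refl
  -[1+i]∉ : ∀ {z} → z ∈ entries (θ₂-pairs is) → -[1+ i ] ≢ z
  -[1+i]∉ z∈ -[1+i]≡z with j , j∈ , z≡ ← ∈-entries-θ₂-pairs⁻ z∈ with z≡ | -[1+i]≡z
  ... | inj₂ refl | refl = All.lookup i∉ j∈ refl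

θ₂-entries-unique : ∀ n → Unique (entries (θ₂-pairs (upTo (suc n))))
θ₂-entries-unique n = entries-θ₂-pairs-unique (UniqueP.upTo⁺ (suc n))

theta2≡mirror : ∀ {n x} → x ∈ signedSetExt n → theta2 n x ≡ mirror x
theta2≡mirror {n} {x} x∈ with ∈-signedSetExt⁻ x∈
... | inj₁ refl =
  transpositions-snd (θ₂-pairs (upTo (suc n))) (θ₂-entries-unique n) (∈-map⁺ _ (∈-upTo⁺ ℕP.≤-refl))
theta2≡mirror {n} {+ i} x∈ | inj₂ i≤n =
  transpositions-fst (θ₂-pairs (upTo (suc n))) (θ₂-entries-unique n) (∈-map⁺ _ (∈-upTo⁺ (s≤s i≤n)))
theta2≡mirror {n} { -[1+ i ]} x∈ | inj₂ i<n =
  transpositions-snd (θ₂-pairs (upTo (suc n))) (θ₂-entries-unique n) (∈-map⁺ _ (∈-upTo⁺ (ℕP.m≤n⇒m≤1+n i<n)))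

-- next x = x + 1 and prev y = y - 1, written so that they compute on the constructors of ℤ.
next : ℤ → ℤ
next x = - mirror x

prev : ℤ → ℤ
prev y = mirror (- y)

next-prev : ∀ y → next (prev y) ≡ y
next-prev y = trans (cong -_ (mirror-involutive (- y))) (ℤP.neg-involutive y)

pList : ℕ → List ℤ
pList n = + 0 ∷ map -_ (oneToN n) ++ reverse (oneToN n)

pList-unique : ∀ n → Unique (pList n)
pList-unique n = All.tabulate 0≢ ∷
  UniqueP.++⁺ (UniqueP.map⁺ ℤP.neg-injective (oneToN-unique n)) (Unique-reverse (oneToN-unique n)) disjoint
  where
  0≢ : ∀ {x} → x ∈ map -_ (oneToN n) ++ reverse (oneToN n) → + 0 ≢ x
  0≢ x∈ refl with ∈-++⁻ (map -_ (oneToN n)) x∈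
  ... | inj₁ 0∈neg with y , y∈ , 0≡-y ← ∈-map⁻ -_ 0∈neg with i , _ , refl ← ∈-oneToN⁻ y∈ with 0≡-y
  ... | ()
  0≢ x∈ refl | inj₂ 0∈rev = 0∉oneToN {n} (reverse⁻ 0∈rev)
  disjoint : ∀ {x} → ¬ (x ∈ map -_ (oneToN n) × x ∈ reverse (oneToN n))
  disjoint (x∈neg , x∈rev) with y , y∈ , refl ← ∈-map⁻ -_ x∈neg with i , _ , refl ← ∈-oneToN⁻ y∈ =
    neg∉oneToN {n} (reverse⁻ x∈rev)

negatives-suc : ∀ n → + 0 ∷ map -_ (oneToN (suc n)) ≡ (+ 0 ∷ map -_ (oneToN n)) ++ [ -[1+ n ] ]
negatives-suc n = cong (+ 0 ∷_) (trans (cong (map -_) (oneToN-suc n)) (ListP.map-++ -_ (oneToN n) [ + suc n ]))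

negatives-last : ∀ n → ∃[ pre ] (+ 0 ∷ map -_ (oneToN n) ≡ pre ++ [ - (+ n) ])
negatives-last zero    = [] , refl
negatives-last (suc n) = + 0 ∷ map -_ (oneToN n) , negatives-suc n

negatives-adjacent : ∀ {n k} → k ℕ.< n → Adjacent (+ 0 ∷ map -_ (oneToN n)) (- (+ k)) -[1+ k ]
negatives-adjacent {suc n} {k} k<n+1 with ℕP.m≤n⇒m<n∨m≡n (ℕP.≤-pred k<n+1)
... | inj₁ k<n = subst (λ L → Adjacent L (- (+ k)) -[1+ k ]) (sym (negatives-suc n))
                   (Adjacent-++ʳ _ (negatives-adjacent k<n))
... | inj₂ refl with pre , e ← negatives-last k =
  pre , [] , trans (negatives-suc k) (trans (cong (_++ [ -[1+ k ] ]) e) (ListP.++-assoc pre _ _))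

reverse-oneToN-suc : ∀ n → reverse (oneToN (suc n)) ≡ + suc n ∷ reverse (oneToN n)
reverse-oneToN-suc n = trans (cong reverse (oneToN-suc n)) (ListP.reverse-++ (oneToN n) [ + suc n ])

reverse-oneToN-adjacent : ∀ {n k} → 1 ℕ.≤ k → k ℕ.< n → Adjacent (reverse (oneToN n)) (+ suc k) (+ k)
reverse-oneToN-adjacent {suc n} {k} k≥1 k<n+1 with ℕP.m≤n⇒m<n∨m≡n (ℕP.≤-pred k<n+1)
... | inj₁ k<n = subst (λ L → Adjacent L (+ suc k) (+ k)) (sym (reverse-oneToN-suc n))
                   (Adjacent-++ˡ [ + suc n ] (reverse-oneToN-adjacent k≥1 k<n))
reverse-oneToN-adjacent {suc (suc n)} {suc n} _ _ | inj₂ refl =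
  [] , reverse (oneToN n) , trans (reverse-oneToN-suc (suc n)) (cong (+ suc (suc n) ∷_) (reverse-oneToN-suc n))

reverse-oneToN-last : ∀ n → ∃[ pre ] (reverse (oneToN (suc n)) ≡ pre ++ [ + 1 ])
reverse-oneToN-last n = _ , ListP.unfold-reverse (+ 1) (map (λ i → + suc i) (applyUpTo suc n))

pCycle-next : ∀ n {x} → InRange n x → x ≢ + n → pCycle n (next x) ≡ x
pCycle-next zero     {+ zero} _ 0≢0 = ⊥-elim (0≢0 refl)
pCycle-next (suc n)  {+ zero} _ _ with pre , e ← reverse-oneToN-last n =
  cyclePerm-Last (+ 0) (map -_ (oneToN (suc n)) ++ pre) (pList-unique (suc n))
    (cong (+ 0 ∷_) (trans (cong (map -_ (oneToN (suc n)) ++_) e) (sym (ListP.++-assoc (map -_ (oneToN (suc n))) pre _))))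
pCycle-next n {+ suc k}    k<n x≢n = cyclePerm-Adjacent (pList-unique n)
  (Adjacent-++ˡ (+ 0 ∷ map -_ (oneToN n)) (reverse-oneToN-adjacent (s≤s z≤n) (ℕP.≤∧≢⇒< k<n (x≢n ∘ cong (λ i → + i)))))
pCycle-next n { -[1+ k ]} k<n _ = cyclePerm-Adjacent (pList-unique n)
  (Adjacent-++ʳ (reverse (oneToN n)) (negatives-adjacent k<n))

pCycle-wrap : ∀ n → pCycle n (- (+ n)) ≡ + n
pCycle-wrap zero    = cyclePerm-singleton (+ 0)
pCycle-wrap (suc n) with pre , e ← negatives-last (suc n) =
  cyclePerm-Adjacent (pList-unique (suc n)) (pre , reverse (oneToN n) , (begin
    pList (suc n)                                           ≡⟨ cong (_++ reverse (oneToN (suc n))) e ⟩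
    (pre ++ [ -[1+ n ] ]) ++ reverse (oneToN (suc n))       ≡⟨ cong ((pre ++ [ -[1+ n ] ]) ++_) (reverse-oneToN-suc n) ⟩
    (pre ++ [ -[1+ n ] ]) ++ + suc n ∷ reverse (oneToN n)   ≡⟨ ListP.++-assoc pre _ _ ⟩
    pre ++ -[1+ n ] ∷ + suc n ∷ reverse (oneToN n)          ∎))
  where open ≡-Reasoning

prev-InRange : ∀ n {y} → InRange n y → y ≢ - (+ n) → InRange n (prev y)
prev-InRange zero    {+ zero}   _    0≢0  = ⊥-elim (0≢0 refl)
prev-InRange (suc n) {+ zero}   _    _    = s≤s z≤n
prev-InRange n       {+ suc k}  k<n  _    = ℕP.<⇒≤ k<n
prev-InRange (suc n) { -[1+ k ]} k<n+1 y≢-n = s≤s (ℕP.≤∧≢⇒< (ℕP.≤-pred k<n+1) (y≢-n ∘ cong -[1+_]))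

prev≢n : ∀ n {y} → InRange n y → prev y ≢ + n
prev≢n n {+ zero}    _   ()
prev≢n n {+ suc k}   k<n e = ℕP.<-irrefl (ℤP.+-injective e) k<n
prev≢n n { -[1+ k ]} _   ()

pCycle≡prev : ∀ n {y} → InRange n y → y ≢ - (+ n) → pCycle n y ≡ prev y
pCycle≡prev n {y} y∈ y≢-n =
  subst (λ t → pCycle n t ≡ prev y) (next-prev y) (pCycle-next n (prev-InRange n y∈ y≢-n) (prev≢n n y∈))

pCycle-InRange : ∀ n {y} → InRange n y → InRange n (pCycle n y)
pCycle-InRange n {y} y∈ with y ≟ - (+ n)
... | yes refl = subst (InRange n) (sym (pCycle-wrap n)) ℕP.≤-refl
... | no y≢-n  = subst (InRange n) (sym (pCycle≡prev n y∈ y≢-n)) (prev-InRange n y∈ y≢-n)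

pCycle-injective : ∀ n {y y′} → InRange n y → InRange n y′ → pCycle n y ≡ pCycle n y′ → y ≡ y′
pCycle-injective n {y} {y′} y∈ y′∈ e with y ≟ - (+ n) | y′ ≟ - (+ n)
... | yes refl | yes refl = refl
... | yes refl | no y′≢-n = ⊥-elim (prev≢n n y′∈ (sym (trans (sym (pCycle-wrap n)) (trans e (pCycle≡prev n y′∈ y′≢-n)))))
... | no y≢-n  | yes refl = ⊥-elim (prev≢n n y∈ (trans (sym (pCycle≡prev n y∈ y≢-n)) (trans e (pCycle-wrap n))))
... | no y≢-n  | no y′≢-n = trans (sym (next-prev y))
  (trans (cong next (trans (sym (pCycle≡prev n y∈ y≢-n)) (trans e (pCycle≡prev n y′∈ y′≢-n)))) (next-prev y′))

pCycle-neg-pCycle : ∀ n {y} → InRange n y → pCycle n (- pCycle n y) ≡ - y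
pCycle-neg-pCycle n {y} y∈ with y ≟ - (+ n)
... | yes refl = trans (cong (λ t → pCycle n (- t)) (pCycle-wrap n))
                      (trans (pCycle-wrap n) (sym (ℤP.neg-involutive (+ n))))
... | no y≢-n  = trans (cong (λ t → pCycle n (- t)) (pCycle≡prev n y∈ y≢-n))
                   (pCycle-next n (InRange-neg y y∈) (y≢-n ∘ trans (sym (ℤP.neg-involutive y)) ∘ cong -_))

pCycle-neg-fixed : ∀ n {x} → InRange n x → pCycle n (- x) ≡ x → x ≡ + n
pCycle-neg-fixed n {x} x∈ e with - x ≟ - (+ n)
... | yes -x≡-n = ℤP.neg-injective -x≡-n
... | no -x≢-n  = ⊥-elim (mirror-x≢x x (trans (cong mirror (sym (ℤP.neg-involutive x)))
                    (trans (sym (pCycle≡prev n (InRange-neg x x∈) -x≢-n)) e)))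

-- θ₁ and s̃

Unique-map-injective : ∀ (f : ℤ → ℕ) {L x y} → Unique (map f L) → x ∈ L → y ∈ L → f x ≡ f y → x ≡ y
Unique-map-injective f {w ∷ L} _        (here refl) (here refl) _ = refl
Unique-map-injective f {w ∷ L} (w∉ ∷ _) (here refl) (there y∈)  e = ⊥-elim (All.lookup w∉ (∈-map⁺ f y∈) e)
Unique-map-injective f {w ∷ L} (w∉ ∷ _) (there x∈)  (here refl) e = ⊥-elim (All.lookup w∉ (∈-map⁺ f x∈) (sym e))
Unique-map-injective f {w ∷ L} (_ ∷ u)  (there x∈)  (there y∈)  e = Unique-map-injective f u x∈ y∈ e

doubled : List ℤ → List ℤ
doubled = concatMap (λ x → - x ∷ x ∷ [])

∈-doubled⁻ : ∀ {L z} → z ∈ doubled L → ∃[ x ] (x ∈ L × (z ≡ - x ⊎ z ≡ x))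
∈-doubled⁻ {x ∷ L} (here refl)         = x , here refl , inj₁ refl
∈-doubled⁻ {x ∷ L} (there (here refl)) = x , here refl , inj₂ refl
∈-doubled⁻ {x ∷ L} (there (there z∈)) with y , y∈ , z≡ ← ∈-doubled⁻ {L} z∈ = y , there y∈ , z≡

∈-doubled⁺ : ∀ {L x} → x ∈ L → - x ∈ doubled L × x ∈ doubled L
∈-doubled⁺ {y ∷ L} (here refl) = here refl , there (here refl)
∈-doubled⁺ {y ∷ L} (there x∈) with -x∈ , x∈′ ← ∈-doubled⁺ {L} x∈ = there (there -x∈) , there (there x∈′)

x≡-x⇒x≡0 : ∀ {x} → x ≡ - x → x ≡ + 0
x≡-x⇒x≡0 {+ zero} _ = refl

doubled-unique : ∀ {L} → Unique (map ∣_∣ L) → (∀ {x} → x ∈ L → x ≢ + 0) → Unique (doubled L)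
doubled-unique {[]}    _          _  = []
doubled-unique {x ∷ L} (x∉ ∷ u) ≢0 =
  ((≢0 (here refl) ∘ x≡-x⇒x≡0 ∘ sym)
    ∷ All.tabulate (λ z∈ -x≡z → absent (ℤP.∣-i∣≡∣i∣ x) (subst (_∈ doubled L) (sym -x≡z) z∈)))
  ∷ All.tabulate (λ z∈ x≡z → absent refl (subst (_∈ doubled L) (sym x≡z) z∈))
  ∷ doubled-unique u (≢0 ∘ there)
  where
  absent : ∀ {z} → ∣ z ∣ ≡ ∣ x ∣ → z ∉ doubled L
  absent |z|≡|x| z∈ with ∈-doubled⁻ {L} z∈
  ... | y , y∈ , inj₁ refl = All.lookup x∉ (∈-map⁺ ∣_∣ y∈) (trans (sym |z|≡|x|) (ℤP.∣-i∣≡∣i∣ y))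
  ... | y , y∈ , inj₂ refl = All.lookup x∉ (∈-map⁺ ∣_∣ y∈) (sym |z|≡|x|)

lastOf : ℤ → List ℤ → ℤ
lastOf c []       = c
lastOf c (x ∷ xs) = lastOf x xs

lastOf-split : ∀ c L → L ≡ [] ⊎ ∃[ L₀ ] (L ≡ L₀ ++ [ lastOf c L ])
lastOf-split c []      = inj₁ refl
lastOf-split c (x ∷ L) with lastOf-split x L
... | inj₁ refl        = inj₂ ([] , refl)
... | inj₂ (L₀ , L≡)   = inj₂ (x ∷ L₀ , cong (x ∷_) L≡)

record IsSignedList (n : ℕ) (A : List ℤ) : Set where
  field
    abs-range  : ∀ {x} → x ∈ A → 1 ℕ.≤ ∣ x ∣ × ∣ x ∣ ℕ.≤ n
    abs-unique : Unique (map ∣_∣ A)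
    abs-onto   : ∀ k → 1 ℕ.≤ k → k ℕ.≤ n → ∃[ x ] (x ∈ A × ∣ x ∣ ≡ k)

module SignedList {n A} (isSignedList : IsSignedList n A) where

  open IsSignedList isSignedList

  bList : List ℤ
  bList = + 0 ∷ doubled A ++ [ lowest n ]

  θ₁ : ℤ → ℤ
  θ₁ = transpositions (pairUp bList)

  s̃ : ℤ → ℤ
  s̃ = cyclePerm (+ 0 ∷ A ++ reverse (map -_ A))

  aₙ : ℤ
  aₙ = lastOf (+ 0) A

  -- θ₁ = (c,-x₁)(x₁,-x₂)⋯(xₖ,-n-1) for the sequence c, x₁, …, xₖ.
  pairs : ℤ → List ℤ → List (ℤ × ℤ)
  pairs c []       = (c , lowest n) ∷ []
  pairs c (x ∷ xs) = (c , - x) ∷ pairs x xs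

  pairUp-bList : ∀ c L → pairUp (c ∷ doubled L ++ [ lowest n ]) ≡ pairs c L
  pairUp-bList c []      = refl
  pairUp-bList c (x ∷ L) = cong ((c , - x) ∷_) (pairUp-bList x L)

  entries-pairs : ∀ c L → entries (pairs c L) ≡ c ∷ doubled L ++ [ lowest n ]
  entries-pairs c []      = refl
  entries-pairs c (x ∷ L) = cong (λ t → c ∷ - x ∷ t) (entries-pairs x L)

  θ₁≡ : ∀ z → θ₁ z ≡ transpositions (pairs (+ 0) A) z
  θ₁≡ z = cong (λ ps → transpositions ps z) (pairUp-bList (+ 0) A)

  abs-injective : ∀ {x y} → x ∈ A → y ∈ A → ∣ x ∣ ≡ ∣ y ∣ → x ≡ y
  abs-injective = Unique-map-injective ∣_∣ abs-unique

  ≢0 : ∀ {x} → x ∈ A → x ≢ + 0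
  ≢0 x∈ refl with () ← proj₁ (abs-range x∈)

  x≢-x : ∀ {x} → x ∈ A → x ≢ - x
  x≢-x x∈ = ≢0 x∈ ∘ x≡-x⇒x≡0

  ∈-doubled-abs : ∀ {z} → z ∈ doubled A → ∃[ x ] (x ∈ A × ∣ z ∣ ≡ ∣ x ∣)
  ∈-doubled-abs z∈ with ∈-doubled⁻ {A} z∈
  ... | x , x∈ , inj₁ refl = x , x∈ , ℤP.∣-i∣≡∣i∣ x
  ... | x , x∈ , inj₂ refl = x , x∈ , refl

  doubled-InRange : ∀ {z} → z ∈ doubled A → InRange n z
  doubled-InRange z∈ with x , x∈ , |z|≡|x| ← ∈-doubled-abs z∈ = subst (ℕ._≤ n) (sym |z|≡|x|) (proj₂ (abs-range x∈))

  doubled-≢0 : ∀ {z} → z ∈ doubled A → z ≢ + 0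
  doubled-≢0 z∈ refl with x , x∈ , 0≡|x| ← ∈-doubled-abs z∈ = ℕP.<-irrefl 0≡|x| (proj₁ (abs-range x∈))

  bList-unique : Unique bList
  bList-unique = All.tabulate 0≢ ∷ UniqueP.++⁺ (doubled-unique abs-unique ≢0) ([] ∷ [])
    λ { (z∈ , here refl) → InRange⇒≢lowest (doubled-InRange z∈) refl }
    where
    0≢ : ∀ {z} → z ∈ doubled A ++ [ lowest n ] → + 0 ≢ z
    0≢ z∈ refl with ∈-++⁻ (doubled A) z∈
    ... | inj₁ 0∈ = doubled-≢0 0∈ refl
    ... | inj₂ (here ())

  P₁ : List (ℤ × ℤ)
  P₁ = pairs (+ 0) A

  entries-unique : Unique (entries P₁)
  entries-unique = subst Unique (sym (entries-pairs (+ 0) A)) bList-unique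

  signedSetExt⊆entries : ∀ {z} → z ∈ signedSetExt n → z ∈ entries P₁
  signedSetExt⊆entries {z} z∈ = subst (z ∈_) (sym (entries-pairs (+ 0) A)) (∈bList (∈-signedSetExt⁻ z∈))
    where
    ∈bList : ∀ {z} → z ≡ lowest n ⊎ InRange n z → z ∈ bList
    ∈bList (inj₁ refl) = there (∈-++⁺ʳ (doubled A) (here refl))
    ∈bList {+ zero}    (inj₂ _) = here refl
    ∈bList {+ suc k}   (inj₂ k<n) with abs-onto (suc k) (s≤s z≤n) k<n
    ... | + .(suc k)  , x∈ , refl = there (∈-++⁺ˡ (proj₂ (∈-doubled⁺ x∈)))
    ... | -[1+ .k ]   , x∈ , refl = there (∈-++⁺ˡ (proj₁ (∈-doubled⁺ x∈)))
    ∈bList { -[1+ k ]} (inj₂ k<n) with abs-onto (suc k) (s≤s z≤n) k<n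
    ... | + .(suc k)  , x∈ , refl = there (∈-++⁺ˡ (proj₁ (∈-doubled⁺ x∈)))
    ... | -[1+ .k ]   , x∈ , refl = there (∈-++⁺ˡ (proj₂ (∈-doubled⁺ x∈)))

  entries⊆signedSetExt : ∀ {z} → z ∈ entries P₁ → z ∈ signedSetExt n
  entries⊆signedSetExt {z} z∈ with subst (z ∈_) (entries-pairs (+ 0) A) z∈
  ... | here refl = InRange⇒∈signedSetExt z≤n
  ... | there z∈′ with ∈-++⁻ (doubled A) z∈′
  ...   | inj₁ z∈doubled = InRange⇒∈signedSetExt (doubled-InRange z∈doubled)
  ...   | inj₂ (here refl) = here refl

  pair-≢ : ∀ {x y} → (x , y) ∈ P₁ → x ≢ y
  pair-≢ p refl = go P₁ entries-unique p
    where
    go : ∀ ps {x} → Unique (entries ps) → (x , x) ∈ ps → ⊥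
    go (_ ∷ ps) (x∉ ∷ _)     (here refl) = All.lookup x∉ (here refl) refl
    go (_ ∷ ps) (_ ∷ _ ∷ u) (there p)   = go ps u p

  θ₁-partner : ∀ {z} → z ∈ signedSetExt n → ∃[ y ] (θ₁ z ≡ y × θ₁ y ≡ z × y ∈ signedSetExt n × y ≢ z)
  θ₁-partner {z} z∈ with ∈entries⁻ {P₁} (signedSetExt⊆entries z∈)
  ... | y , inj₁ p = y , trans (θ₁≡ z) (transpositions-fst P₁ entries-unique p) ,
                         trans (θ₁≡ y) (transpositions-snd P₁ entries-unique p) ,
                         entries⊆signedSetExt (snd∈entries p) , pair-≢ p ∘ sym
  ... | y , inj₂ p = y , trans (θ₁≡ z) (transpositions-snd P₁ entries-unique p) ,
                         trans (θ₁≡ y) (transpositions-fst P₁ entries-unique p) ,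
                         entries⊆signedSetExt (fst∈entries p) , pair-≢ p

  θ₁-closed : ∀ {z} → z ∈ signedSetExt n → θ₁ z ∈ signedSetExt n
  θ₁-closed z∈ with y , θ₁z≡y , _ , y∈ , _ ← θ₁-partner z∈ = subst (_∈ signedSetExt n) (sym θ₁z≡y) y∈

  θ₁-involutive : ∀ {z} → z ∈ signedSetExt n → θ₁ (θ₁ z) ≡ z
  θ₁-involutive z∈ with y , θ₁z≡y , θ₁y≡z , _ ← θ₁-partner z∈ = trans (cong θ₁ θ₁z≡y) θ₁y≡z

  θ₁-no-fixed-point : ∀ {z} → z ∈ signedSetExt n → θ₁ z ≢ z
  θ₁-no-fixed-point z∈ with y , θ₁z≡y , _ , _ , y≢z ← θ₁-partner z∈ = y≢z ∘ trans (sym θ₁z≡y)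

  θ₁-injective : ∀ {x y} → x ∈ signedSetExt n → y ∈ signedSetExt n → θ₁ x ≡ θ₁ y → x ≡ y
  θ₁-injective x∈ y∈ e = trans (sym (θ₁-involutive x∈)) (trans (cong θ₁ e) (θ₁-involutive y∈))

  last-pair : ∀ c L → (lastOf c L , lowest n) ∈ pairs c L
  last-pair c []      = here refl
  last-pair c (x ∷ L) = there (last-pair x L)

  θ₁-lowest : θ₁ (lowest n) ≡ aₙ
  θ₁-lowest = trans (θ₁≡ (lowest n)) (transpositions-snd P₁ entries-unique (last-pair (+ 0) A))

  θ₁-aₙ : θ₁ aₙ ≡ lowest n
  θ₁-aₙ = trans (θ₁≡ aₙ) (transpositions-fst P₁ entries-unique (last-pair (+ 0) A))

  ∈-pairs⁻ : ∀ c L {x y} → (x , y) ∈ pairs c L → (y ≡ lowest n × x ≡ lastOf c L) ⊎ Adjacent (c ∷ L) x (- y)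
  ∈-pairs⁻ c []      (here refl) = inj₁ (refl , refl)
  ∈-pairs⁻ c (z ∷ L) (here refl) = inj₂ ([] , L , cong (λ t → c ∷ t ∷ L) (sym (ℤP.neg-involutive z)))
  ∈-pairs⁻ c (z ∷ L) (there p) with ∈-pairs⁻ z L p
  ... | inj₁ r                   = inj₁ r
  ... | inj₂ (xs , ys , e)       = inj₂ (c ∷ xs , ys , cong (c ∷_) e)

  S : List ℤ
  S = + 0 ∷ A ++ reverse (map -_ A)

  S-unique : Unique S
  S-unique = All.tabulate 0≢ ∷
    UniqueP.++⁺ A-unique (Unique-reverse (UniqueP.map⁺ ℤP.neg-injective A-unique)) disjoint
    where
    A-unique = UniqueP.map⁻ abs-unique
    0≢ : ∀ {z} → z ∈ A ++ reverse (map -_ A) → + 0 ≢ z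
    0≢ z∈ refl with ∈-++⁻ A z∈
    ... | inj₁ 0∈A = ≢0 0∈A refl
    ... | inj₂ 0∈rev with y , y∈ , 0≡-y ← ∈-map⁻ -_ (reverse⁻ 0∈rev) =
      ≢0 y∈ (trans (sym (ℤP.neg-involutive y)) (cong -_ (sym 0≡-y)))
    disjoint : ∀ {z} → ¬ (z ∈ A × z ∈ reverse (map -_ A))
    disjoint (z∈A , z∈rev) with y , y∈ , refl ← ∈-map⁻ -_ (reverse⁻ z∈rev) =
      x≢-x z∈A (trans (abs-injective z∈A y∈ (ℤP.∣-i∣≡∣i∣ y)) (sym (ℤP.neg-involutive y)))

  S-shape : ∀ {L} → A ≡ L → S ≡ + 0 ∷ L ++ reverse (map -_ L)
  S-shape = cong (λ L → + 0 ∷ L ++ reverse (map -_ L))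

  s̃-adjacent : ∀ {x x′} → Adjacent (+ 0 ∷ A) x x′ → s̃ x ≡ x′
  s̃-adjacent adj = cyclePerm-Adjacent S-unique (Adjacent-++ʳ (reverse (map -_ A)) adj)

  s̃-adjacent-neg : ∀ {x x′} → Adjacent (+ 0 ∷ A) x x′ → s̃ (- x′) ≡ - x
  s̃-adjacent-neg {x} {x′} ([] , ys , e) with refl , A≡ ← ListP.∷-injective e =
    cyclePerm-Last (+ 0) (x′ ∷ ys ++ reverse (map -_ ys)) S-unique (trans (S-shape A≡) (cong (λ t → + 0 ∷ x′ ∷ t)
      (trans (cong (ys ++_) (ListP.unfold-reverse (- x′) (map -_ ys)))
             (sym (ListP.++-assoc ys (reverse (map -_ ys)) [ - x′ ])))))
  s̃-adjacent-neg {x} {x′} (_ ∷ xs , ys , e) with refl , A≡ ← ListP.∷-injective e =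
    cyclePerm-Adjacent S-unique (Adjacent-++ˡ (+ 0 ∷ A) (Adjacent-reverse (Adjacent-map -_ (xs , ys , A≡))))

  s̃-aₙ : s̃ aₙ ≡ - aₙ
  s̃-aₙ with lastOf-split (+ 0) A
  ... | inj₁ A≡[] = subst (λ L → cyclePerm (+ 0 ∷ L ++ reverse (map -_ L)) (lastOf (+ 0) L) ≡ - lastOf (+ 0) L)
                          (sym A≡[]) (cyclePerm-singleton (+ 0))
  ... | inj₂ (L₀ , A≡) = cyclePerm-Adjacent S-unique (+ 0 ∷ L₀ , reverse (map -_ L₀) , (begin
      S
    ≡⟨ S-shape A≡ ⟩
      + 0 ∷ (L₀ ++ [ aₙ ]) ++ reverse (map -_ (L₀ ++ [ aₙ ]))
    ≡⟨ cong (λ t → + 0 ∷ (L₀ ++ [ aₙ ]) ++ reverse t) (ListP.map-++ -_ L₀ [ aₙ ]) ⟩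
      + 0 ∷ (L₀ ++ [ aₙ ]) ++ reverse (map -_ L₀ ++ [ - aₙ ])
    ≡⟨ cong (λ t → + 0 ∷ (L₀ ++ [ aₙ ]) ++ t) (ListP.reverse-++ (map -_ L₀) [ - aₙ ]) ⟩
      + 0 ∷ (L₀ ++ [ aₙ ]) ++ - aₙ ∷ reverse (map -_ L₀)
    ≡⟨ cong (+ 0 ∷_) (ListP.++-assoc L₀ [ aₙ ] _) ⟩
      (+ 0 ∷ L₀) ++ aₙ ∷ - aₙ ∷ reverse (map -_ L₀)
    ∎))
    where open ≡-Reasoning

  -- s̃ steps along 0, a₁, …, aₙ, while θ₁ pairs each entry with minus the next one.
  s̃≡-θ₁ : ∀ {z} → InRange n z → z ≢ aₙ → s̃ z ≡ - θ₁ z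
  s̃≡-θ₁ {z} z∈ z≢aₙ with ∈entries⁻ {P₁} (signedSetExt⊆entries (InRange⇒∈signedSetExt z∈))
  ... | y , inj₁ p with ∈-pairs⁻ (+ 0) A p
  ...   | inj₁ (_ , z≡aₙ) = ⊥-elim (z≢aₙ z≡aₙ)
  ...   | inj₂ adj =
    trans (s̃-adjacent adj) (cong -_ (sym (trans (θ₁≡ z) (transpositions-fst P₁ entries-unique p))))
  s̃≡-θ₁ {z} z∈ z≢aₙ | y , inj₂ p with ∈-pairs⁻ (+ 0) A p
  ...   | inj₁ (z≡lowest , _) = ⊥-elim (InRange⇒≢lowest z∈ z≡lowest)
  ...   | inj₂ adj = trans (cong s̃ (sym (ℤP.neg-involutive z))) (trans (s̃-adjacent-neg adj)
    (cong -_ (sym (trans (θ₁≡ z) (transpositions-snd P₁ entries-unique p)))))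

-- The permutations of the theorem

module Assembly {n A} (isSignedList : IsSignedList n A) where

  open SignedList isSignedList

  σ : ℤ → ℤ
  σ x = pCycle n (s̃ x)

  τ : ℤ → ℤ
  τ x = θ₁ (theta2 n x)

  J : ℤ → ℤ
  J x = pCycle n (- x)

  aₙ∈signedSetExt : aₙ ∈ signedSetExt n
  aₙ∈signedSetExt = subst (_∈ signedSetExt n) θ₁-lowest (θ₁-closed (here refl))

  aₙ-InRange : InRange n aₙ
  aₙ-InRange = ∈signedSetExt⇒InRange aₙ∈signedSetExt (θ₁-no-fixed-point (here refl) ∘ trans θ₁-lowest)

  θ₁-≢aₙ : ∀ {z} → InRange n z → θ₁ z ≢ aₙ
  θ₁-≢aₙ z∈ θ₁z≡aₙ = InRange⇒≢lowest z∈
    (trans (sym (θ₁-involutive (InRange⇒∈signedSetExt z∈))) (trans (cong θ₁ θ₁z≡aₙ) θ₁-aₙ))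

  θ₁-InRange : ∀ {z} → InRange n z → z ≢ aₙ → InRange n (θ₁ z)
  θ₁-InRange z∈ z≢aₙ = ∈signedSetExt⇒InRange (θ₁-closed z∈E)
    λ θ₁z≡lowest → z≢aₙ (trans (sym (θ₁-involutive z∈E)) (trans (cong θ₁ θ₁z≡lowest) θ₁-lowest))
    where z∈E = InRange⇒∈signedSetExt z∈

  s̃-InRange : ∀ {z} → InRange n z → InRange n (s̃ z)
  s̃-InRange {z} z∈ with z ≟ aₙ
  ... | yes refl = subst (InRange n) (sym s̃-aₙ) (InRange-neg aₙ aₙ-InRange)
  ... | no z≢aₙ  = subst (InRange n) (sym (s̃≡-θ₁ z∈ z≢aₙ)) (InRange-neg (θ₁ z) (θ₁-InRange z∈ z≢aₙ))

  s̃-injective : ∀ {x y} → InRange n x → InRange n y → s̃ x ≡ s̃ y → x ≡ y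
  s̃-injective {x} {y} x∈ y∈ e with x ≟ aₙ | y ≟ aₙ
  ... | yes refl | yes refl = refl
  ... | yes refl | no y≢aₙ  =
    ⊥-elim (θ₁-≢aₙ y∈ (sym (ℤP.neg-injective (trans (sym s̃-aₙ) (trans e (s̃≡-θ₁ y∈ y≢aₙ))))))
  ... | no x≢aₙ  | yes refl =
    ⊥-elim (θ₁-≢aₙ x∈ (sym (ℤP.neg-injective (trans (sym s̃-aₙ) (trans (sym e) (s̃≡-θ₁ x∈ x≢aₙ))))))
  ... | no x≢aₙ  | no y≢aₙ  = θ₁-injective (InRange⇒∈signedSetExt x∈) (InRange⇒∈signedSetExt y∈)
    (ℤP.neg-injective (trans (sym (s̃≡-θ₁ x∈ x≢aₙ)) (trans e (s̃≡-θ₁ y∈ y≢aₙ))))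

  s̃-neg-s̃ : ∀ {y} → InRange n y → s̃ (- s̃ y) ≡ - y
  s̃-neg-s̃ {y} y∈ with y ≟ aₙ
  ... | yes refl = trans (cong (s̃ ∘ -_) s̃-aₙ) (trans (cong s̃ (ℤP.neg-involutive aₙ)) s̃-aₙ)
  ... | no y≢aₙ  = begin
      s̃ (- s̃ y)         ≡⟨ cong (s̃ ∘ -_) (s̃≡-θ₁ y∈ y≢aₙ) ⟩
      s̃ (- - θ₁ y)      ≡⟨ cong s̃ (ℤP.neg-involutive (θ₁ y)) ⟩
      s̃ (θ₁ y)          ≡⟨ s̃≡-θ₁ (θ₁-InRange y∈ y≢aₙ) (θ₁-≢aₙ y∈) ⟩
      - θ₁ (θ₁ y)       ≡⟨ cong -_ (θ₁-involutive (InRange⇒∈signedSetExt y∈)) ⟩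
      - y               ∎
    where open ≡-Reasoning

  σ-closed : Closed σ (signedSet n)
  σ-closed = ∈-signedSet⁺ ∘ pCycle-InRange n ∘ s̃-InRange ∘ ∈-signedSet⁻

  σ-injective : InjectiveOn σ (signedSet n)
  σ-injective x∈ y∈ e = s̃-injective (∈-signedSet⁻ x∈) (∈-signedSet⁻ y∈)
    (pCycle-injective n (s̃-InRange (∈-signedSet⁻ x∈)) (s̃-InRange (∈-signedSet⁻ y∈)) e)

  τ≡θ₁∘mirror : ∀ {x} → x ∈ signedSetExt n → τ x ≡ θ₁ (mirror x)
  τ≡θ₁∘mirror = cong θ₁ ∘ theta2≡mirror

  τ-closed : Closed τ (signedSetExt n)
  τ-closed x∈ = subst (_∈ signedSetExt n) (sym (τ≡θ₁∘mirror x∈)) (θ₁-closed (mirror-signedSetExt x∈))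

  τ-injective : InjectiveOn τ (signedSetExt n)
  τ-injective x∈ y∈ e = mirror-injective (θ₁-injective (mirror-signedSetExt x∈) (mirror-signedSetExt y∈)
    (trans (sym (τ≡θ₁∘mirror x∈)) (trans e (τ≡θ₁∘mirror y∈))))

  -- σ (τ x) = p (s̃ (θ₁ (-1-x))) = p (-(-1-x)) = p (x+1) = x.
  σ∘τ≡id : ∀ {x} → InRange n x → x ≢ + n → x ≢ mirror aₙ → σ (τ x) ≡ x
  σ∘τ≡id {x} x∈ x≢n x≢mirror-aₙ = begin
      pCycle n (s̃ (τ x))              ≡⟨ cong (pCycle n ∘ s̃) (τ≡θ₁∘mirror x∈E) ⟩
      pCycle n (s̃ (θ₁ (mirror x)))    ≡⟨ cong (pCycle n) (s̃≡-θ₁ (θ₁-InRange mirror-x∈ mirror-x≢aₙ) (θ₁-≢aₙ mirror-x∈)) ⟩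
      pCycle n (- θ₁ (θ₁ (mirror x))) ≡⟨ cong (pCycle n ∘ -_) (θ₁-involutive (mirror-signedSetExt x∈E)) ⟩
      pCycle n (next x)               ≡⟨ pCycle-next n x∈ x≢n ⟩
      x                               ∎
    where
    open ≡-Reasoning
    x∈E = InRange⇒∈signedSetExt x∈
    mirror-x∈ : InRange n (mirror x)
    mirror-x∈ = ∈signedSetExt⇒InRange (mirror-signedSetExt x∈E) (x≢n ∘ mirror-injective)
    mirror-x≢aₙ : mirror x ≢ aₙ
    mirror-x≢aₙ e = x≢mirror-aₙ (trans (sym (mirror-involutive x)) (cong mirror e))

  J-closed : Closed J (signedSet n)
  J-closed {x} = ∈-signedSet⁺ ∘ pCycle-InRange n ∘ InRange-neg x ∘ ∈-signedSet⁻

  σJσ≗J : ∀ {y} → y ∈ signedSet n → σ (J (σ y)) ≡ J y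
  σJσ≗J y∈ = trans (cong (pCycle n ∘ s̃) (pCycle-neg-pCycle n (s̃-InRange (∈-signedSet⁻ y∈))))
                   (cong (pCycle n) (s̃-neg-s̃ (∈-signedSet⁻ y∈)))

  σ≡J⇒aₙ : ∀ {y} → y ∈ signedSet n → σ y ≡ J y → y ≡ aₙ
  σ≡J⇒aₙ {y} y∈ e with y ≟ aₙ
  ... | yes y≡aₙ = y≡aₙ
  ... | no y≢aₙ  = ⊥-elim (θ₁-no-fixed-point (InRange⇒∈signedSetExt y∈′) (ℤP.neg-injective
      (trans (sym (s̃≡-θ₁ y∈′ y≢aₙ)) (pCycle-injective n (s̃-InRange y∈′) (InRange-neg y y∈′) e))))
    where y∈′ = ∈-signedSet⁻ y∈

  τ-lowest : τ (lowest n) ≡ θ₁ (+ n)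
  τ-lowest = τ≡θ₁∘mirror (here refl)

  τ-n : τ (+ n) ≡ aₙ
  τ-n = trans (τ≡θ₁∘mirror (InRange⇒∈signedSetExt ℕP.≤-refl)) θ₁-lowest

  σ-aₙ : σ aₙ ≡ pCycle n (- aₙ)
  σ-aₙ = cong (pCycle n) s̃-aₙ

  open CycleCounts (signedSet n) (lowest n) σ τ (signedSet-unique n) (lowest<InRange ∘ ∈-signedSet⁻)
    σ-closed σ-injective τ-closed τ-injective

  count-cycles : count Fτ (signedSetExt n) ≡ suc (count Fσ (signedSet n))
  count-cycles with aₙ ≟ + n
  ... | yes aₙ≡n = count-τ-inverse (trans τ-lowest (trans (cong θ₁ (sym aₙ≡n)) θ₁-aₙ)) σ∘τ≗id
    where
    σ∘τ≗id : ∀ {y} → y ∈ signedSet n → σ (τ y) ≡ y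
    σ∘τ≗id {y} y∈ with y ≟ + n
    ... | yes refl = trans (cong σ τ-n) (trans σ-aₙ (trans (cong (pCycle n ∘ -_) aₙ≡n) (pCycle-wrap n)))
    ... | no y≢n   =
      σ∘τ≡id (∈-signedSet⁻ y∈) y≢n (InRange⇒≢lowest (∈-signedSet⁻ y∈) ∘ flip trans (cong mirror aₙ≡n))
  ... | no aₙ≢n = Orbit.Reflected.count-τ-rerouted (∈-signedSet⁺ aₙ-InRange)
      J J-closed σJσ≗J (pCycle-neg-fixed n ∘ ∈-signedSet⁻) (sym σ-aₙ) σ≡J⇒aₙ aₙ≢n
      τ-σaₙ τ-n σ-τ-lowest
      (λ y∈ y≢σaₙ y≢n → σ∘τ≡id (∈-signedSet⁻ y∈) y≢n (y≢σaₙ ∘ flip trans (sym σaₙ≡mirror)))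
    where
    σaₙ≡mirror : σ aₙ ≡ mirror aₙ
    σaₙ≡mirror = trans σ-aₙ (trans (pCycle≡prev n (InRange-neg aₙ aₙ-InRange) (aₙ≢n ∘ ℤP.neg-injective))
                                   (cong mirror (ℤP.neg-involutive aₙ)))
    τ-σaₙ : τ (σ aₙ) ≡ lowest n
    τ-σaₙ = trans (cong τ σaₙ≡mirror) (trans (τ≡θ₁∘mirror (mirror-signedSetExt aₙ∈signedSetExt))
                                             (trans (cong θ₁ (mirror-involutive aₙ)) θ₁-aₙ))
    σ-τ-lowest : σ (τ (lowest n)) ≡ + n
    σ-τ-lowest = trans (cong σ τ-lowest) (trans (cong (pCycle n)
      (trans (s̃≡-θ₁ (θ₁-InRange ℕP.≤-refl (aₙ≢n ∘ sym)) (θ₁-≢aₙ ℕP.≤-refl))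
             (cong -_ (θ₁-involutive (InRange⇒∈signedSetExt ℕP.≤-refl))))) (pCycle-wrap n))

  numCycles-τ : numCycles (signedSetExt n) τ ≡ suc (numCycles (signedSet n) σ)
  numCycles-τ = begin
      numCycles (signedSetExt n) τ   ≡⟨ length-filter-T? Fτ (signedSetExt n) ⟩
      count Fτ (signedSetExt n)      ≡⟨ count-cycles ⟩
      suc (count Fσ (signedSet n))   ≡⟨ cong suc (length-filter-T? Fσ (signedSet n)) ⟨
      suc (numCycles (signedSet n) σ) ∎
    where open ≡-Reasoning

-- Signed permutations

injective⇒surjective : ∀ {m} (f : Fin m → Fin m) → Injective _≡_ _≡_ f → ∀ j → ∃[ i ] (f i ≡ j)
injective⇒surjective {suc m} f f-injective j with FinP.any? (λ i → f i FinP.≟ j)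
... | yes hit  = hit
... | no ¬hit = ⊥-elim (ℕP.<-irrefl refl (FinP.injective⇒≤ {f = squeezed} squeezed-injective))
  where
  j≢f : ∀ i → j ≢ f i
  j≢f i j≡fi = ¬hit (i , sym j≡fi)
  squeezed : Fin (suc m) → Fin m
  squeezed i = punchOut (j≢f i)
  squeezed-injective : Injective _≡_ _≡_ squeezed
  squeezed-injective e = f-injective (FinP.punchOut-injective (j≢f _) (j≢f _) e)

Unique-map-toList : ∀ {n} (a : Vec ℤ n) (f : ℤ → ℕ) → Injective _≡_ _≡_ (λ i → f (Vec.lookup a i)) →
  Unique (map f (Vec.toList a))
Unique-map-toList []      f _           = []
Unique-map-toList (x ∷ a) f f-injective =
  All.tabulate fresh ∷ Unique-map-toList a f (λ e → FinP.suc-injective (f-injective e))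
  where
  fresh : ∀ {y} → y ∈ map f (Vec.toList a) → f x ≢ y
  fresh y∈ fx≡y with z , z∈ , refl ← ∈-map⁻ f y∈ with f-injective {zero} {suc (VecAny.index (∈-toList⁻ z∈))}
    (trans fx≡y (cong f (VecAnyP.lookup-index (∈-toList⁻ z∈))))
  ... | ()

IsSignedPerm⇒IsSignedList : ∀ {n} (a : Vec ℤ n) → IsSignedPerm n a → IsSignedList n (Vec.toList a)
IsSignedPerm⇒IsSignedList {n} a (range , abs-injective) = record
  { abs-range  = λ x∈ →
      subst (λ x → 1 ℕ.≤ ∣ x ∣ × ∣ x ∣ ℕ.≤ n) (sym (VecAnyP.lookup-index (∈-toList⁻ x∈))) (range _)
  ; abs-unique = Unique-map-toList a ∣_∣ abs-injective
  ; abs-onto   = abs-onto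
  }
  where
  position : Fin n → Fin n
  position i = fromℕ< (ℕP.<-≤-trans (ℕP.∸-monoˡ-< (ℕP.n<1+n _) (proj₁ (range i))) (proj₂ (range i)))
  toℕ-position : ∀ i → toℕ (position i) ≡ ∣ Vec.lookup a i ∣ ∸ 1
  toℕ-position i = FinP.toℕ-fromℕ< _
  position-injective : Injective _≡_ _≡_ position
  position-injective {i} {j} e = abs-injective (ℕP.∸-cancelʳ-≡ (proj₁ (range i)) (proj₁ (range j))
    (trans (sym (toℕ-position i)) (trans (cong toℕ e) (toℕ-position j))))
  abs-onto : ∀ k → 1 ℕ.≤ k → k ℕ.≤ n → ∃[ x ] (x ∈ Vec.toList a × ∣ x ∣ ≡ k)
  abs-onto (suc k) _ k<n with i , pos-i≡k ← injective⇒surjective position position-injective (fromℕ< k<n) =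
    Vec.lookup a i , ∈-toList⁺ (∈-lookup i a) ,
    ℕP.∸-cancelʳ-≡ (proj₁ (range i)) (s≤s z≤n)
      (trans (sym (toℕ-position i)) (trans (cong toℕ pos-i≡k) (FinP.toℕ-fromℕ< k<n)))

-- σ and τ of Assembly are, definitionally, the two permutations of the statement.
mainTheorem6 : (n : ℕ) (a : Vec ℤ n) → IsSignedPerm n a →
    numCycles (signedSet n) (λ x → pCycle n (sTilde a x))
      ≡ numCycles (signedSetExt n) (λ x → theta1 a (theta2 n x)) ∸ 1
mainTheorem6 n a isSignedPerm =
  sym (cong (_∸ 1) (Assembly.numCycles-τ (IsSignedPerm⇒IsSignedList a isSignedPerm)))
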